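{- The generating function $F_{312}(x,1,z)=\sum_{n\ge0}\sum_{\pi\in\mathfrak{S}_n(312)}x^{\mathrm{fp}(\pi)}z^n$ is given by the continued fraction $$F_{312}(x,1,z)=\cfrac{1}{1-C_0(x-1)z-\cfrac{z}{1-C_1(x-1)z^2-\cfrac{z}{1-C_2(x-1)z^3-\cfrac{z}{1-C_3(x-1)z^4-\cfrac{z}{\ddots}}}}},$$ i.e. at the $n$-th level ($n\ge0$) the term is $C_n(x-1)z^{n+1}$, where $C_n$ is the $n$-th Catalan number (so $C_0=C_1=1$, $C_2=2$, $C_3=5$).
   Context: For permutations $\pi=\pi_1\cdots\pi_n\in\mathfrak{S}_n$ and $\sigma\in\mathfrak{S}_m$, $\pi$ contains $\sigma$ if there are indices $i_1<\dots<i_m$ such that $\pi_{i_1}\cdots\pi_{i_m}$ is in the same relative order as $\sigma$; otherwise $\pi$ avoids $\sigma$. $\mathfrak{S}_n(312)$ is the set of $312$-avoiding permutations in $\mathfrak{S}_n$ ($\mathfrak{S}_0$ contains only the empty permutation). $\mathrm{fp}(\pi)=|\{i:\pi_i=i\}|$. $C_n=\frac{1}{n+1}\binom{2n}{n}$. -}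

module Defs where

open import Data.Bool using (Bool; true; false; _∧_; _∨_; not; if_then_else_)
open import Data.Nat as ℕ using (ℕ; zero; suc; _≡ᵇ_; _<ᵇ_; _∸_)
open import Data.Nat.Combinatorics using (_C_)
open import Data.Nat.DivMod using (_/_)
open import Data.List using (List; []; _∷_; map; concatMap; length; filterᵇ; upTo; zipWith)
open import Data.Bool.ListAction using (and; any)
open import Data.Integer as ℤ using (ℤ; +_; -_)

-- Permutations as words π₁ ⋯ πₙ (lists of naturals, values 1..n)

wordsOver : List ℕ → ℕ → List (List ℕ)
wordsOver vs zero    = [] ∷ []
wordsOver vs (suc k) = concatMap (λ v → map (v ∷_) (wordsOver vs k)) vs

elemᵇ : ℕ → List ℕ → Bool
elemᵇ a []       = false
elemᵇ a (b ∷ bs) = (a ≡ᵇ b) ∨ elemᵇ a bs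

distinctᵇ : List ℕ → Bool
distinctᵇ []       = true
distinctᵇ (a ∷ as) = not (elemᵇ a as) ∧ distinctᵇ as

Sym : ℕ → List (List ℕ)
Sym n = filterᵇ distinctᵇ (wordsOver (map suc (upTo n)) n)

subseqs : List ℕ → List (List ℕ)
subseqs []       = [] ∷ []
subseqs (a ∷ as) = map (a ∷_) (subseqs as) ++ subseqs as
  where open Data.List using (_++_)

sameOrderᵇ : List ℕ → List ℕ → Bool
sameOrderᵇ []       []       = true
sameOrderᵇ (a ∷ as) (b ∷ bs) =
  and (zipWith (λ a' b' → (a <ᵇ a') ≡ᵇB (b <ᵇ b')) as bs) ∧ sameOrderᵇ as bs
  where
  _≡ᵇB_ : Bool → Bool → Bool
  true  ≡ᵇB y = y
  false ≡ᵇB y = not y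
sameOrderᵇ _        _        = false

containsᵇ : List ℕ → List ℕ → Bool
containsᵇ π σ = any (λ s → sameOrderᵇ s σ) (subseqs π)

avoidsᵇ : List ℕ → List ℕ → Bool
avoidsᵇ π σ = not (containsᵇ π σ)

Sym312 : ℕ → List (List ℕ)
Sym312 n = filterᵇ (λ π → avoidsᵇ π (3 ∷ 1 ∷ 2 ∷ [])) (Sym n)

fpFrom : ℕ → List ℕ → ℕ
fpFrom i []       = 0
fpFrom i (a ∷ as) = (if a ≡ᵇ i then 1 else 0) ℕ.+ fpFrom (suc i) as

fp : List ℕ → ℕ
fp = fpFrom 1

count312 : ℕ → ℕ → ℕ
count312 n k = length (filterᵇ (λ π → fp π ≡ᵇ k) (Sym312 n))

catalan : ℕ → ℕ
catalan n = ((2 ℕ.* n) C n) / suc n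

-- Formal power series in two variables x, z with integer coefficients.
-- A series S is given by its coefficients: S i j = [xⁱ zʲ] S.

Series : Set
Series = ℕ → ℕ → ℤ

sumUpTo : ℕ → (ℕ → ℤ) → ℤ
sumUpTo zero    f = f 0
sumUpTo (suc n) f = sumUpTo n f ℤ.+ f (suc n)

oneS : Series
oneS zero zero = + 1
oneS _    _    = + 0

xS : Series
xS 1 zero = + 1
xS _ _    = + 0

zS : Series
zS zero 1 = + 1
zS _    _ = + 0

_⊕_ : Series → Series → Series
(A ⊕ B) i j = A i j ℤ.+ B i j

⊝_ : Series → Series
(⊝ A) i j = - A i j

_⊛_ : Series → Series → Series
(A ⊛ B) i j = sumUpTo i (λ a → sumUpTo j (λ c → A a c ℤ.* B (i ∸ a) (j ∸ c)))

scaleS : ℤ → Series → Series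
scaleS c A i j = c ℤ.* A i j

powS : Series → ℕ → Series
powS A zero    = oneS
powS A (suc k) = A ⊛ powS A k

-- 1/(1 - A) for a series A with no z⁰-terms (A ≡ 0 mod z):
-- the geometric series Σ_k Aᵏ; since Aᵏ ≡ 0 mod zᵏ, the coefficient of
-- xⁱ zⁿ only receives contributions from k ≤ n.
invOneMinus : Series → Series
invOneMinus A i n = sumUpTo n (λ k → powS A k i n)

-- The continued fraction
--   K_m = 1 / (1 - C_m (x-1) z^{m+1} - z K_{m+1}),
-- truncated after d levels (the innermost tail replaced by 1).
-- The infinite continued fraction K_0 is the z-adic limit of cf 0 d.

levelTerm : ℕ → Series
levelTerm m = scaleS (+ catalan m) ((xS ⊕ (⊝ oneS)) ⊛ powS zS (suc m))

cf : ℕ → ℕ → Series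
cf m zero    = oneS
cf m (suc d) = invOneMinus (levelTerm m ⊕ (zS ⊛ cf (suc m) d))

-- Let Gₘ(x, z) = ∑ xᵏ zⁿ #{π ∈ 𝔖ₙ(312) : #{i : πᵢ + m = i} = k}, so that G₀ = F₃₁₂(x, 1, z).
-- Everything to the left of the entry 1 of a 312-avoiding permutation is smaller than everything
-- to its right, so every nonempty π ∈ 𝔖(312) is uniquely π = (α + 1) 1 (β + |α| + 1) with α and β
-- 312-avoiding. The points of π counted at level m are those of α counted at level m + 1, the
-- entry 1 when |α| = m, and those of β counted at level m. For |α| = m no point of α counts at
-- level m + 1, so the Cₘ = |𝔖ₘ(312)| permutations α of size m carry x where Gₘ₊₁ has 1, and
--   Gₘ = 1 + (Cₘ (x − 1) zᵐ⁺¹ + z Gₘ₊₁) Gₘ.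
-- A solution of G = 1 + A G with A ≡ 0 (mod z) is determined modulo z^d by A modulo z^d, so by
-- induction on d the continued fraction truncated after d levels agrees with G₀ below z-degree d.
-- That |𝔖ₘ(312)| is the Catalan number follows from the same decomposition via the ballot numbers
-- [zⁿ] C(z)ʲ = binom(2n+j−1, n) − binom(2n+j−1, n−1).

module Submission where

open import Algebra.Core using (Op₂)
open import Algebra.Structures using (IsCommutativeSemiring)
open import Data.Bool.Base using (Bool; true; false; T; not; if_then_else_)
open import Data.Bool.Properties using (T-∧; T-∨)
open import Data.Integer.Base using (ℤ; +_; -_; 0ℤ)
import Data.Integer.Properties as ℤₚ
open import Data.List.Base using (List; []; _∷_; _++_; map; concatMap; length; filterᵇ; upTo; applyUpTo)
import Data.List.Properties as Listₚ
open import Data.List.Membership.Propositional using (_∈_; _∉_; find; lose)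
open import Data.List.Membership.Propositional.Properties
  using (∈-map⁺; ∈-map⁻; ∈-++⁺ˡ; ∈-++⁺ʳ; ∈-++⁻; ∈-∃++; ∈-concatMap⁺; ∈-concatMap⁻; ∈-upTo⁺; ∈-upTo⁻; ∈-filter⁺; ∈-filter⁻)
open import Data.List.Membership.Propositional.Properties.WithK using (unique∧set⇒bag)
open import Data.List.Relation.Binary.BagAndSetEquality using (∼bag⇒↭)
open import Data.List.Relation.Binary.Disjoint.Propositional using (Disjoint)
open import Data.List.Relation.Binary.Permutation.Propositional using (_↭_)
open import Data.List.Relation.Binary.Permutation.Propositional.Properties using (↭-length; filter-↭)
open import Data.List.Relation.Binary.Sublist.Propositional using (_⊆_; []; _∷_; _∷ʳ_; ⊆-refl; ⊆-trans; from∈; to∈)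
import Data.List.Relation.Binary.Sublist.Propositional.Properties as Sublistₚ
open import Data.List.Relation.Unary.All as All using (All; []; _∷_)
import Data.List.Relation.Unary.All.Properties as Allₚ
open import Data.List.Relation.Unary.AllPairs as AllPairs using ([]; _∷_)
open import Data.List.Relation.Unary.Any using (here; there)
open import Data.List.Relation.Unary.Any.Properties using (any⁺; any⁻)
open import Data.List.Relation.Unary.Unique.Propositional using (Unique)
import Data.List.Relation.Unary.Unique.Propositional.Properties as Uniqueₚ
open import Data.Nat.Base as ℕ using (ℕ; zero; suc; _∸_; _≤_; _<_; z≤n; s≤s; NonZero)
open import Data.Nat.Combinatorics using (_C_; nCk≡nC[n∸k]; nCk+nC[k+1]≡[n+1]C[k+1]; nCk≡n!/k![n-k]!; k![n∸k]!∣n!)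
open import Data.Nat.DivMod using (_/_; m*n/n≡m; m*[n/m]≡n)
import Data.Nat.Properties as ℕₚ
open import Data.Nat.Tactic.RingSolver using (solve-∀)
open import Data.List.Membership.DecPropositional ℕₚ._≟_ using (_∈?_)
open import Data.Product.Base using (_×_; _,_; proj₁; proj₂; ∃; ∃₂)
open import Data.Sum.Base using (inj₁; inj₂)
open import Function using (id; _∘_)
open import Function.Bundles using (_⇔_; mk⇔; Equivalence)
import Function.Properties.Equivalence as ⇔
open import Relation.Binary.Definitions using (tri<; tri≈; tri>)
open import Relation.Binary.PropositionalEquality
open import Relation.Nullary using (¬_; yes; no; contradiction)
open import Relation.Nullary.Decidable using (dec-true; dec-false; does-⇔; T?)

open import Defs

module RangeSum {A : Set} {add mul : Op₂ A} {0# 1# : A}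
                (isCommutativeSemiring : IsCommutativeSemiring _≡_ add mul 0# 1#) where

  open IsCommutativeSemiring isCommutativeSemiring
    using (+-assoc; +-comm; +-identityˡ; +-identityʳ; *-comm; distribˡ)
  open ≡-Reasoning

  private
    infixl 6 _+_
    infixl 7 _*_

    _+_ _*_ : Op₂ A
    _+_ = add
    _*_ = mul

  ∑≤ : ℕ → (ℕ → A) → A
  ∑≤ zero    f = f 0
  ∑≤ (suc n) f = ∑≤ n f + f (suc n)

  syntax ∑≤ n (λ k → e) = ∑[ k ≤ n ] e

  private
    below : ∀ {n} {P : ℕ → Set} → (∀ k → k ≤ suc n → P k) → ∀ k → k ≤ n → P k
    below h k k≤n = h k (ℕₚ.m≤n⇒m≤1+n k≤n)

  ∑-cong : ∀ n {f g : ℕ → A} → (∀ k → k ≤ n → f k ≡ g k) → ∑≤ n f ≡ ∑≤ n g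
  ∑-cong zero    f≗g = f≗g 0 z≤n
  ∑-cong (suc n) f≗g = cong₂ _+_ (∑-cong n (below f≗g)) (f≗g (suc n) ℕₚ.≤-refl)

  ∑-zero : ∀ n {f : ℕ → A} → (∀ k → k ≤ n → f k ≡ 0#) → ∑≤ n f ≡ 0#
  ∑-zero zero    f≗0 = f≗0 0 z≤n
  ∑-zero (suc n) f≗0 = begin
    ∑≤ n _ + _  ≡⟨ cong₂ _+_ (∑-zero n (below f≗0)) (f≗0 (suc n) ℕₚ.≤-refl) ⟩
    0# + 0#     ≡⟨ +-identityˡ 0# ⟩
    0#          ∎

  ∑-distrib-+ : ∀ n (f g : ℕ → A) → ∑[ k ≤ n ] (f k + g k) ≡ ∑≤ n f + ∑≤ n g
  ∑-distrib-+ zero    f g = refl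
  ∑-distrib-+ (suc n) f g = begin
    ∑[ k ≤ n ] (f k + g k) + (f (suc n) + g (suc n))  ≡⟨ cong (_+ _) (∑-distrib-+ n f g) ⟩
    (F + G) + (f (suc n) + g (suc n))                 ≡⟨ medial F G (f (suc n)) (g (suc n)) ⟩
    (F + f (suc n)) + (G + g (suc n))                 ∎
    where
    F = ∑≤ n f
    G = ∑≤ n g
    medial : ∀ a b c d → (a + b) + (c + d) ≡ (a + c) + (b + d)
    medial a b c d = begin
      (a + b) + (c + d)  ≡⟨ +-assoc a b (c + d) ⟩
      a + (b + (c + d))  ≡⟨ cong (_+_ a) (sym (+-assoc b c d)) ⟩
      a + ((b + c) + d)  ≡⟨ cong (λ t → a + (t + d)) (+-comm b c) ⟩
      a + ((c + b) + d)  ≡⟨ cong (_+_ a) (+-assoc c b d) ⟩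
      a + (c + (b + d))  ≡⟨ sym (+-assoc a c (b + d)) ⟩
      (a + c) + (b + d)  ∎

  *-distribˡ-∑ : ∀ n a (f : ℕ → A) → a * ∑≤ n f ≡ ∑[ k ≤ n ] (a * f k)
  *-distribˡ-∑ zero    a f = refl
  *-distribˡ-∑ (suc n) a f = trans (distribˡ a (∑≤ n f) (f (suc n))) (cong (_+ _) (*-distribˡ-∑ n a f))

  *-distribʳ-∑ : ∀ n a (f : ℕ → A) → ∑≤ n f * a ≡ ∑[ k ≤ n ] (f k * a)
  *-distribʳ-∑ n a f = begin
    ∑≤ n f * a            ≡⟨ *-comm (∑≤ n f) a ⟩
    a * ∑≤ n f            ≡⟨ *-distribˡ-∑ n a f ⟩
    ∑[ k ≤ n ] (a * f k)  ≡⟨ ∑-cong n (λ k _ → *-comm a (f k)) ⟩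
    ∑[ k ≤ n ] (f k * a)  ∎

  ∑-comm : ∀ m n (f : ℕ → ℕ → A) → ∑[ i ≤ m ] ∑[ j ≤ n ] f i j ≡ ∑[ j ≤ n ] ∑[ i ≤ m ] f i j
  ∑-comm zero    n f = refl
  ∑-comm (suc m) n f = begin
    ∑[ i ≤ m ] ∑[ j ≤ n ] f i j + ∑[ j ≤ n ] f (suc m) j  ≡⟨ cong (_+ ∑≤ n (f (suc m))) (∑-comm m n f) ⟩
    ∑[ j ≤ n ] ∑[ i ≤ m ] f i j + ∑[ j ≤ n ] f (suc m) j  ≡⟨ sym (∑-distrib-+ n _ _) ⟩
    ∑[ j ≤ n ] (∑[ i ≤ m ] f i j + f (suc m) j)           ∎

  ∑-head : ∀ n (f : ℕ → A) → ∑≤ (suc n) f ≡ f 0 + ∑[ k ≤ n ] f (suc k)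
  ∑-head zero    f = refl
  ∑-head (suc n) f = trans (cong (_+ f (suc (suc n))) (∑-head n f)) (+-assoc (f 0) _ _)

  ∑-single : ∀ n {f : ℕ → A} k₀ → k₀ ≤ n → (∀ k → k ≤ n → k ≢ k₀ → f k ≡ 0#) → ∑≤ n f ≡ f k₀
  ∑-single zero    .zero z≤n _ = refl
  ∑-single (suc n) {f} k₀ k₀≤1+n f≗0 with k₀ ℕₚ.≟ suc n
  ... | yes refl = begin
    ∑≤ n f + f (suc n)  ≡⟨ cong (_+ f (suc n)) (∑-zero n (λ k k≤n → below f≗0 k k≤n (ℕₚ.<⇒≢ (s≤s k≤n)))) ⟩
    0# + f (suc n)      ≡⟨ +-identityˡ _ ⟩
    f (suc n)           ∎
  ... | no k₀≢1+n = begin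
    ∑≤ n f + f (suc n)  ≡⟨ cong₂ _+_ (∑-single n k₀ (ℕₚ.≤-pred (ℕₚ.≤∧≢⇒< k₀≤1+n k₀≢1+n)) (below f≗0))
                                     (f≗0 (suc n) ℕₚ.≤-refl (k₀≢1+n ∘ sym)) ⟩
    f k₀ + 0#           ≡⟨ +-identityʳ _ ⟩
    f k₀                ∎

  ∑-truncate : ∀ {m n} {f : ℕ → A} → m ≤ n → (∀ k → k ≤ n → m < k → f k ≡ 0#) → ∑≤ n f ≡ ∑≤ m f
  ∑-truncate {m} {zero}  z≤n _ = refl
  ∑-truncate {m} {suc n} {f} m≤1+n f≗0 with m ℕₚ.≟ suc n
  ... | yes refl = refl
  ... | no m≢1+n = begin
    ∑≤ n f + f (suc n)  ≡⟨ cong₂ _+_ (∑-truncate m≤n (below f≗0)) (f≗0 (suc n) ℕₚ.≤-refl (s≤s m≤n)) ⟩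
    ∑≤ m f + 0#         ≡⟨ +-identityʳ _ ⟩
    ∑≤ m f              ∎
    where
    m≤n : m ≤ n
    m≤n = ℕₚ.≤-pred (ℕₚ.≤∧≢⇒< m≤1+n m≢1+n)

  ∑-triangle : ∀ n (f : ℕ → ℕ → A) →
               ∑[ i ≤ n ] ∑[ a ≤ i ] f a i ≡ ∑[ a ≤ n ] ∑[ b ≤ n ∸ a ] f a (a ℕ.+ b)
  ∑-triangle zero    f = refl
  ∑-triangle (suc n) f = begin
    ∑[ i ≤ n ] ∑[ a ≤ i ] f a i + (∑[ a ≤ n ] f a (suc n) + f (suc n) (suc n))
      ≡⟨ cong (_+ (∑[ a ≤ n ] f a (suc n) + f (suc n) (suc n))) (∑-triangle n f) ⟩
    ∑[ a ≤ n ] ∑[ b ≤ n ∸ a ] f a (a ℕ.+ b) + (∑[ a ≤ n ] f a (suc n) + f (suc n) (suc n))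
      ≡⟨ sym (+-assoc _ _ _) ⟩
    (∑[ a ≤ n ] ∑[ b ≤ n ∸ a ] f a (a ℕ.+ b) + ∑[ a ≤ n ] f a (suc n)) + f (suc n) (suc n)
      ≡⟨ cong₂ _+_ (sym (∑-distrib-+ n _ _)) (cong (f (suc n)) (sym (ℕₚ.+-identityʳ (suc n)))) ⟩
    ∑[ a ≤ n ] (∑[ b ≤ n ∸ a ] f a (a ℕ.+ b) + f a (suc n)) + f (suc n) (suc n ℕ.+ 0)
      ≡⟨ cong₂ _+_ (∑-cong n (λ a a≤n → extend-row a a≤n)) (cong (λ k → ∑[ b ≤ k ] f (suc n) (suc n ℕ.+ b)) (sym (ℕₚ.n∸n≡0 n))) ⟩
    ∑[ a ≤ n ] ∑[ b ≤ suc n ∸ a ] f a (a ℕ.+ b) + ∑[ b ≤ n ∸ n ] f (suc n) (suc n ℕ.+ b) ∎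
    where
    extend-row : ∀ a → a ≤ n → ∑[ b ≤ n ∸ a ] f a (a ℕ.+ b) + f a (suc n) ≡ ∑[ b ≤ suc n ∸ a ] f a (a ℕ.+ b)
    extend-row a a≤n rewrite ℕₚ.+-∸-assoc 1 a≤n =
      cong (λ k → ∑[ b ≤ n ∸ a ] f a (a ℕ.+ b) + f a k) (sym (trans (ℕₚ.+-suc a (n ∸ a)) (cong suc (ℕₚ.m+[n∸m]≡n a≤n))))

module ℕΣ = RangeSum ℕₚ.+-*-isCommutativeSemiring

module ℤΣ = RangeSum ℤₚ.+-*-isCommutativeSemiring

module FormalSeries where

  open ℤΣ
  open import Data.Integer.Base using (_+_; _*_)
  open ≡-Reasoning

  ZDivisible : Series → Set
  ZDivisible A = ∀ i → A i 0 ≡ 0ℤ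

  infix 4 _≈[<_]_

  _≈[<_]_ : Series → ℕ → Series → Set
  F ≈[< d ] G = ∀ i n → n < d → F i n ≡ G i n

  sumUpTo≡∑ : ∀ n (f : ℕ → ℤ) → sumUpTo n f ≡ ∑≤ n f
  sumUpTo≡∑ zero    f = refl
  sumUpTo≡∑ (suc n) f = cong (_+ f (suc n)) (sumUpTo≡∑ n f)

  ⊛-coeff : ∀ A B i j → (A ⊛ B) i j ≡ ∑[ a ≤ i ] ∑[ c ≤ j ] (A a c * B (i ∸ a) (j ∸ c))
  ⊛-coeff A B i j = trans (sumUpTo≡∑ i _) (∑-cong i (λ a _ → sumUpTo≡∑ j _))

  ⊛-coeff-suc : ∀ A B → ZDivisible A → ∀ i n →
                (A ⊛ B) i (suc n) ≡ ∑[ a ≤ i ] ∑[ c ≤ n ] (A a (suc c) * B (i ∸ a) (n ∸ c))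
  ⊛-coeff-suc A B zdA i n = trans (⊛-coeff A B i (suc n)) (∑-cong i λ a _ → let
      rest : ℤ
      rest = ∑[ c ≤ n ] (A a (suc c) * B (i ∸ a) (n ∸ c))
    in begin
      ∑[ c ≤ suc n ] (A a c * B (i ∸ a) (suc n ∸ c))  ≡⟨ ∑-head n _ ⟩
      A a 0 * B (i ∸ a) (suc n) + rest                 ≡⟨ cong (λ t → t * B (i ∸ a) (suc n) + rest) (zdA a) ⟩
      0ℤ * B (i ∸ a) (suc n) + rest                    ≡⟨ ℤₚ.+-identityˡ rest ⟩
      rest                                             ∎)

  ⊛-zDivisibleˡ : ∀ A B → ZDivisible A → ZDivisible (A ⊛ B)
  ⊛-zDivisibleˡ A B zdA i =
    trans (⊛-coeff A B i 0) (∑-zero i (λ a _ → trans (cong (_* B (i ∸ a) 0) (zdA a)) (ℤₚ.*-zeroˡ (B (i ∸ a) 0))))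

  ⊛-zDivisibleʳ : ∀ A B → ZDivisible B → ZDivisible (A ⊛ B)
  ⊛-zDivisibleʳ A B zdB i =
    trans (⊛-coeff A B i 0) (∑-zero i (λ a _ → trans (cong (A a 0 *_) (zdB (i ∸ a))) (ℤₚ.*-zeroʳ (A a 0))))

  ⊛-cong-< : ∀ {A A' F G d} → ZDivisible A → ZDivisible A' →
             A ≈[< suc d ] A' → F ≈[< d ] G → A ⊛ F ≈[< suc d ] A' ⊛ G
  ⊛-cong-< {A} {A'} {F} {G} zdA zdA' A≈A' F≈G i zero _ =
    trans (⊛-zDivisibleˡ A F zdA i) (sym (⊛-zDivisibleˡ A' G zdA' i))
  ⊛-cong-< {A} {A'} {F} {G} zdA zdA' A≈A' F≈G i (suc n) (s≤s n<d) = begin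
    (A ⊛ F) i (suc n)                                             ≡⟨ ⊛-coeff-suc A F zdA i n ⟩
    ∑[ a ≤ i ] ∑[ c ≤ n ] (A a (suc c) * F (i ∸ a) (n ∸ c))       ≡⟨ ∑-cong i (λ a _ → ∑-cong n (λ c c≤n → cong₂ _*_
                                                                       (A≈A' a (suc c) (s≤s (ℕₚ.≤-<-trans c≤n n<d)))
                                                                       (F≈G (i ∸ a) (n ∸ c) (ℕₚ.≤-<-trans (ℕₚ.m∸n≤m n c) n<d)))) ⟩
    ∑[ a ≤ i ] ∑[ c ≤ n ] (A' a (suc c) * G (i ∸ a) (n ∸ c))      ≡⟨ sym (⊛-coeff-suc A' G zdA' i n) ⟩
    (A' ⊛ G) i (suc n)                                            ∎

  fixpoint-unique : ∀ {A A' F G} d → ZDivisible A → ZDivisible A' → A ≈[< d ] A' →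
                    F ≈[< d ] oneS ⊕ (A ⊛ F) → G ≈[< d ] oneS ⊕ (A' ⊛ G) → F ≈[< d ] G
  fixpoint-unique zero zdA zdA' A≈A' fixF fixG i n ()
  fixpoint-unique {A} {A'} {F} {G} (suc d) zdA zdA' A≈A' fixF fixG i n n<1+d = begin
    F i n                        ≡⟨ fixF i n n<1+d ⟩
    oneS i n + (A ⊛ F) i n       ≡⟨ cong (_+_ (oneS i n)) (⊛-cong-< zdA zdA' A≈A' F≈G i n n<1+d) ⟩
    oneS i n + (A' ⊛ G) i n      ≡⟨ sym (fixG i n n<1+d) ⟩
    G i n                        ∎
    where
    weaken : ∀ {P Q} → P ≈[< suc d ] Q → P ≈[< d ] Q
    weaken P≈Q i n n<d = P≈Q i n (ℕₚ.m≤n⇒m≤1+n n<d)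
    F≈G : F ≈[< d ] G
    F≈G = fixpoint-unique d zdA zdA' (weaken A≈A') (weaken fixF) (weaken fixG)

  zS-zDivisible : ZDivisible zS
  zS-zDivisible zero    = refl
  zS-zDivisible (suc i) = refl

  zS⊛-coeff-suc : ∀ H i n → (zS ⊛ H) i (suc n) ≡ H i n
  zS⊛-coeff-suc H i n = begin
    (zS ⊛ H) i (suc n)                                      ≡⟨ ⊛-coeff-suc zS H zS-zDivisible i n ⟩
    ∑[ a ≤ i ] ∑[ c ≤ n ] (zS a (suc c) * H (i ∸ a) (n ∸ c))  ≡⟨ ∑-single i 0 z≤n only-a≡0 ⟩
    ∑[ c ≤ n ] (zS 0 (suc c) * H i (n ∸ c))                   ≡⟨ ∑-single n 0 z≤n only-c≡0 ⟩
    + 1 * H i n                                             ≡⟨ ℤₚ.*-identityˡ (H i n) ⟩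
    H i n                                                   ∎
    where
    only-a≡0 : ∀ a → a ≤ i → a ≢ 0 → ∑[ c ≤ n ] (zS a (suc c) * H (i ∸ a) (n ∸ c)) ≡ 0ℤ
    only-a≡0 zero    _ a≢0 = contradiction refl a≢0
    only-a≡0 (suc a) _ _   = ∑-zero n (λ _ _ → refl)
    only-c≡0 : ∀ c → c ≤ n → c ≢ 0 → zS 0 (suc c) * H i (n ∸ c) ≡ 0ℤ
    only-c≡0 zero    _ c≢0 = contradiction refl c≢0
    only-c≡0 (suc c) _ _   = refl

  powS-coeff-low : ∀ A → ZDivisible A → ∀ {k j} i → j < k → powS A k i j ≡ 0ℤ
  powS-coeff-low A zdA {suc k} {zero}  i _ = ⊛-zDivisibleˡ A (powS A k) zdA i
  powS-coeff-low A zdA {suc k} {suc j} i (s≤s j<k) =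
    trans (⊛-coeff-suc A (powS A k) zdA i j) (∑-zero i (λ a _ → ∑-zero j (λ c _ →
      trans (cong (A a (suc c) *_) (powS-coeff-low A zdA (i ∸ a) (ℕₚ.≤-<-trans (ℕₚ.m∸n≤m j c) j<k)))
            (ℤₚ.*-zeroʳ (A a (suc c))))))

  -- Aᵏ contributes nothing to the coefficient of zⁿ once k > n, which is what lets the
  -- finite sum defining invOneMinus be re-indexed inside a product.
  ∑-powS-⊛ : ∀ A → ZDivisible A → ∀ i n →
             ∑[ k ≤ n ] (A ⊛ powS A k) i (suc n) ≡ (A ⊛ invOneMinus A) i (suc n)
  ∑-powS-⊛ A zdA i n = begin
    ∑[ k ≤ n ] (A ⊛ P k) i (suc n)
      ≡⟨ ∑-cong n (λ k _ → ⊛-coeff-suc A (P k) zdA i n) ⟩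
    ∑[ k ≤ n ] ∑[ a ≤ i ] ∑[ c ≤ n ] (A a (suc c) * P k (i ∸ a) (n ∸ c))
      ≡⟨ ∑-comm n i _ ⟩
    ∑[ a ≤ i ] ∑[ k ≤ n ] ∑[ c ≤ n ] (A a (suc c) * P k (i ∸ a) (n ∸ c))
      ≡⟨ ∑-cong i (λ a _ → ∑-comm n n _) ⟩
    ∑[ a ≤ i ] ∑[ c ≤ n ] ∑[ k ≤ n ] (A a (suc c) * P k (i ∸ a) (n ∸ c))
      ≡⟨ ∑-cong i (λ a _ → ∑-cong n (λ c _ → factor a c)) ⟩
    ∑[ a ≤ i ] ∑[ c ≤ n ] (A a (suc c) * invOneMinus A (i ∸ a) (n ∸ c))
      ≡⟨ sym (⊛-coeff-suc A (invOneMinus A) zdA i n) ⟩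
    (A ⊛ invOneMinus A) i (suc n) ∎
    where
    P : ℕ → Series
    P = powS A
    factor : ∀ a c → ∑[ k ≤ n ] (A a (suc c) * P k (i ∸ a) (n ∸ c)) ≡ A a (suc c) * invOneMinus A (i ∸ a) (n ∸ c)
    factor a c = begin
      ∑[ k ≤ n ] (A a (suc c) * P k (i ∸ a) (n ∸ c))
        ≡⟨ ∑-truncate (ℕₚ.m∸n≤m n c) (λ k _ n∸c<k → trans (cong (A a (suc c) *_) (powS-coeff-low A zdA (i ∸ a) n∸c<k))
                                                           (ℤₚ.*-zeroʳ (A a (suc c)))) ⟩
      ∑[ k ≤ n ∸ c ] (A a (suc c) * P k (i ∸ a) (n ∸ c))
        ≡⟨ sym (*-distribˡ-∑ (n ∸ c) (A a (suc c)) _) ⟩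
      A a (suc c) * ∑[ k ≤ n ∸ c ] P k (i ∸ a) (n ∸ c)
        ≡⟨ cong (A a (suc c) *_) (sym (sumUpTo≡∑ (n ∸ c) _)) ⟩
      A a (suc c) * invOneMinus A (i ∸ a) (n ∸ c) ∎

  invOneMinus-fixpoint : ∀ A → ZDivisible A → ∀ i n → invOneMinus A i n ≡ (oneS ⊕ (A ⊛ invOneMinus A)) i n
  invOneMinus-fixpoint A zdA i zero =
    sym (trans (cong (_+_ (oneS i 0)) (⊛-zDivisibleˡ A (invOneMinus A) zdA i)) (ℤₚ.+-identityʳ (oneS i 0)))
  invOneMinus-fixpoint A zdA i (suc n) = begin
    invOneMinus A i (suc n)                                      ≡⟨ sumUpTo≡∑ (suc n) _ ⟩
    ∑[ k ≤ suc n ] powS A k i (suc n)                            ≡⟨ ∑-head n _ ⟩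
    oneS i (suc n) + ∑[ k ≤ n ] (A ⊛ powS A k) i (suc n)          ≡⟨ cong (_+_ (oneS i (suc n))) (∑-powS-⊛ A zdA i n) ⟩
    oneS i (suc n) + (A ⊛ invOneMinus A) i (suc n)               ∎

  oneS-coeff-suc : ∀ i n → oneS i (suc n) ≡ 0ℤ
  oneS-coeff-suc zero    n = refl
  oneS-coeff-suc (suc i) n = refl

  oneS-coeff-∸ : ∀ {a b} → a ≤ b → a ≢ b → (∀ x → oneS (b ∸ a) x ≡ 0ℤ) × (∀ x → oneS x (b ∸ a) ≡ 0ℤ)
  oneS-coeff-∸ {a} {b} a≤b a≢b with b ∸ a in eq
  ... | zero  = contradiction (ℕₚ.≤-antisym a≤b (ℕₚ.m∸n≡0⇒m≤n eq)) a≢b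
  ... | suc k = (λ _ → refl) , (λ x → oneS-coeff-suc x k)

  ⊛-oneS-identityʳ : ∀ A i j → (A ⊛ oneS) i j ≡ A i j
  ⊛-oneS-identityʳ A i j = begin
    (A ⊛ oneS) i j                                            ≡⟨ ⊛-coeff A oneS i j ⟩
    ∑[ a ≤ i ] ∑[ c ≤ j ] (A a c * oneS (i ∸ a) (j ∸ c))       ≡⟨ ∑-single i i ℕₚ.≤-refl only-a≡i ⟩
    ∑[ c ≤ j ] (A i c * oneS (i ∸ i) (j ∸ c))                 ≡⟨ ∑-single j j ℕₚ.≤-refl only-c≡j ⟩
    A i j * oneS (i ∸ i) (j ∸ j)                              ≡⟨ cong₂ (λ a c → A i j * oneS a c) (ℕₚ.n∸n≡0 i) (ℕₚ.n∸n≡0 j) ⟩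
    A i j * + 1                                               ≡⟨ ℤₚ.*-identityʳ (A i j) ⟩
    A i j                                                     ∎
    where
    only-a≡i : ∀ a → a ≤ i → a ≢ i → ∑[ c ≤ j ] (A a c * oneS (i ∸ a) (j ∸ c)) ≡ 0ℤ
    only-a≡i a a≤i a≢i = ∑-zero j (λ c _ →
      trans (cong (A a c *_) (proj₁ (oneS-coeff-∸ a≤i a≢i) (j ∸ c))) (ℤₚ.*-zeroʳ (A a c)))
    only-c≡j : ∀ c → c ≤ j → c ≢ j → A i c * oneS (i ∸ i) (j ∸ c) ≡ 0ℤ
    only-c≡j c c≤j c≢j = trans (cong (A i c *_) (proj₂ (oneS-coeff-∸ c≤j c≢j) (i ∸ i))) (ℤₚ.*-zeroʳ (A i c))

  ⊛-zS-shift : ∀ A H i n → (A ⊛ (zS ⊛ H)) i (suc n) ≡ (A ⊛ H) i n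
  ⊛-zS-shift A H i n = begin
    (A ⊛ (zS ⊛ H)) i (suc n)                                        ≡⟨ ⊛-coeff A (zS ⊛ H) i (suc n) ⟩
    ∑[ a ≤ i ] ∑[ c ≤ suc n ] (A a c * (zS ⊛ H) (i ∸ a) (suc n ∸ c))   ≡⟨ ∑-cong i (λ a _ → drop-last a) ⟩
    ∑[ a ≤ i ] ∑[ c ≤ n ] (A a c * H (i ∸ a) (n ∸ c))                 ≡⟨ sym (⊛-coeff A H i n) ⟩
    (A ⊛ H) i n                                                     ∎
    where
    zH : Series
    zH = zS ⊛ H
    last≡0 : ∀ a → A a (suc n) * zH (i ∸ a) (n ∸ n) ≡ 0ℤ
    last≡0 a = trans (cong (λ k → A a (suc n) * zH (i ∸ a) k) (ℕₚ.n∸n≡0 n))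
                     (trans (cong (A a (suc n) *_) (⊛-zDivisibleˡ zS H zS-zDivisible (i ∸ a))) (ℤₚ.*-zeroʳ (A a (suc n))))
    drop-last : ∀ a → ∑[ c ≤ suc n ] (A a c * zH (i ∸ a) (suc n ∸ c)) ≡ ∑[ c ≤ n ] (A a c * H (i ∸ a) (n ∸ c))
    drop-last a = begin
      ∑[ c ≤ n ] (A a c * zH (i ∸ a) (suc n ∸ c)) + A a (suc n) * zH (i ∸ a) (n ∸ n)
        ≡⟨ cong₂ _+_ (∑-cong n (λ c c≤n → cong (λ k → A a c * zH (i ∸ a) k) (ℕₚ.+-∸-assoc 1 c≤n))) (last≡0 a) ⟩
      ∑[ c ≤ n ] (A a c * zH (i ∸ a) (suc (n ∸ c))) + 0ℤ
        ≡⟨ ℤₚ.+-identityʳ _ ⟩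
      ∑[ c ≤ n ] (A a c * zH (i ∸ a) (suc (n ∸ c)))
        ≡⟨ ∑-cong n (λ c _ → cong (A a c *_) (zS⊛-coeff-suc H (i ∸ a) (n ∸ c))) ⟩
      ∑[ c ≤ n ] (A a c * H (i ∸ a) (n ∸ c)) ∎

  ⊛-zPow : ∀ A k i j → (A ⊛ powS zS k) i (k ℕ.+ j) ≡ A i j
  ⊛-zPow A zero    i j = ⊛-oneS-identityʳ A i j
  ⊛-zPow A (suc k) i j = trans (⊛-zS-shift A (powS zS k) i (k ℕ.+ j)) (⊛-zPow A k i j)

  ⊛-zPow-low : ∀ A {k j} i → j < k → (A ⊛ powS zS k) i j ≡ 0ℤ
  ⊛-zPow-low A {suc k} {zero}  i _ = ⊛-zDivisibleʳ A (powS zS (suc k)) (⊛-zDivisibleˡ zS (powS zS k) zS-zDivisible) i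
  ⊛-zPow-low A {suc k} {suc j} i (s≤s j<k) = trans (⊛-zS-shift A (powS zS k) i j) (⊛-zPow-low A i j<k)

  x-1 : Series
  x-1 = xS ⊕ (⊝ oneS)

  x-1-coeff-suc : ∀ a j → x-1 a (suc j) ≡ 0ℤ
  x-1-coeff-suc zero          j = refl
  x-1-coeff-suc (suc zero)    j = refl
  x-1-coeff-suc (suc (suc a)) j = refl

  levelTerm-zDivisible : ∀ m → ZDivisible (levelTerm m)
  levelTerm-zDivisible m a =
    trans (cong (+ catalan m *_) (⊛-zPow-low x-1 {suc m} a (s≤s z≤n))) (ℤₚ.*-zeroʳ (+ catalan m))

  levelTerm-coeff-diag : ∀ m a → levelTerm m a (suc m) ≡ + catalan m * x-1 a 0
  levelTerm-coeff-diag m a = cong (+ catalan m *_) (begin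
    (x-1 ⊛ powS zS (suc m)) a (suc m)        ≡⟨ cong ((x-1 ⊛ powS zS (suc m)) a) (sym (ℕₚ.+-identityʳ (suc m))) ⟩
    (x-1 ⊛ powS zS (suc m)) a (suc m ℕ.+ 0)  ≡⟨ ⊛-zPow x-1 (suc m) a 0 ⟩
    x-1 a 0                                 ∎)

  levelTerm-coeff-off : ∀ m a c → c ≢ m → levelTerm m a (suc c) ≡ 0ℤ
  levelTerm-coeff-off m a c c≢m = trans (cong (+ catalan m *_) coeff≡0) (ℤₚ.*-zeroʳ (+ catalan m))
    where
    coeff≡0 : (x-1 ⊛ powS zS (suc m)) a (suc c) ≡ 0ℤ
    coeff≡0 with ℕₚ.<-cmp c m
    ... | tri< c<m _ _ = ⊛-zPow-low x-1 a (s≤s c<m)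
    ... | tri≈ _ c≡m _ = contradiction c≡m c≢m
    ... | tri> _ _ m<c = begin
      (x-1 ⊛ powS zS (suc m)) a (suc c)
        ≡⟨ cong (λ k → (x-1 ⊛ powS zS (suc m)) a (suc k)) (sym (ℕₚ.m+[n∸m]≡n (ℕₚ.<⇒≤ m<c))) ⟩
      (x-1 ⊛ powS zS (suc m)) a (suc m ℕ.+ (c ∸ m))
        ≡⟨ ⊛-zPow x-1 (suc m) a (c ∸ m) ⟩
      x-1 a (c ∸ m)
        ≡⟨ cong (x-1 a) (ℕₚ.+-∸-assoc 1 m<c) ⟩
      x-1 a (suc (c ∸ suc m))
        ≡⟨ x-1-coeff-suc a (c ∸ suc m) ⟩
      0ℤ ∎

  cfLevel : ℕ → Series → Series
  cfLevel m H = levelTerm m ⊕ (zS ⊛ H)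

  cfLevel-zDivisible : ∀ m H → ZDivisible (cfLevel m H)
  cfLevel-zDivisible m H a = cong₂ _+_ (levelTerm-zDivisible m a) (⊛-zDivisibleˡ zS H zS-zDivisible a)

  cf-converges : (G : ℕ → Series) → (∀ m i n → G m i n ≡ (oneS ⊕ (cfLevel m (G (suc m)) ⊛ G m)) i n) →
                 ∀ d m → cf m d ≈[< d ] G m
  cf-converges G fixG zero    m i n ()
  cf-converges G fixG (suc d) m =
    fixpoint-unique (suc d) (cfLevel-zDivisible m (cf (suc m) d)) (cfLevel-zDivisible m (G (suc m))) levels≈
      (λ i n _ → invOneMinus-fixpoint _ (cfLevel-zDivisible m (cf (suc m) d)) i n) (λ i n _ → fixG m i n)
    where
    levels≈ : cfLevel m (cf (suc m) d) ≈[< suc d ] cfLevel m (G (suc m))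
    levels≈ i n n<1+d = cong (_+_ (levelTerm m i n))
      (⊛-cong-< {zS} {zS} {cf (suc m) d} {G (suc m)} zS-zDivisible zS-zDivisible (λ _ _ _ → refl)
                (cf-converges G fixG d (suc m)) i n n<1+d)

module CatalanClosedForm (c : ℕ → ℕ) (c-zero : c 0 ≡ 1)
                         (c-suc : ∀ n → c (suc n) ≡ ℕΣ.∑≤ n (λ a → c a ℕ.* c (n ∸ a))) where

  open ℕΣ
  open import Data.Nat.Base using (_+_; _*_; _!)
  open ≡-Reasoning

  -- ballot j n is the coefficient of zⁿ in C(z)ʲ, where C(z) = ∑ cₙ zⁿ.
  ballot : ℕ → ℕ → ℕ
  ballot zero    zero    = 1
  ballot zero    (suc n) = 0
  ballot (suc j) n       = ∑[ i ≤ n ] (c i * ballot j (n ∸ i))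

  ballot-zeroʳ : ∀ j → ballot j 0 ≡ 1
  ballot-zeroʳ zero    = refl
  ballot-zeroʳ (suc j) = cong₂ _*_ c-zero (ballot-zeroʳ j)

  ballot-one : ∀ n → ballot 1 n ≡ c n
  ballot-one n = begin
    ∑[ i ≤ n ] (c i * ballot 0 (n ∸ i))  ≡⟨ ∑-single n n ℕₚ.≤-refl only-i≡n ⟩
    c n * ballot 0 (n ∸ n)              ≡⟨ cong (λ k → c n * ballot 0 k) (ℕₚ.n∸n≡0 n) ⟩
    c n * 1                             ≡⟨ ℕₚ.*-identityʳ (c n) ⟩
    c n                                 ∎
    where
    only-i≡n : ∀ i → i ≤ n → i ≢ n → c i * ballot 0 (n ∸ i) ≡ 0
    only-i≡n i i≤n i≢n with n ∸ i in eq
    ... | zero  = contradiction (ℕₚ.≤-antisym i≤n (ℕₚ.m∸n≡0⇒m≤n eq)) i≢n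
    ... | suc _ = ℕₚ.*-zeroʳ (c i)

  -- The recurrence for c says C = 1 + z C², hence Cʲ⁺¹ = Cʲ + z Cʲ⁺².
  ballot-step : ∀ j n → ballot (suc j) (suc n) ≡ ballot j (suc n) + ballot (suc (suc j)) n
  ballot-step j n = begin
    ∑[ i ≤ suc n ] (c i * ballot j (suc n ∸ i))
      ≡⟨ ∑-head n _ ⟩
    c 0 * ballot j (suc n) + ∑[ i ≤ n ] (c (suc i) * ballot j (n ∸ i))
      ≡⟨ cong₂ _+_ (trans (cong (_* ballot j (suc n)) c-zero) (ℕₚ.*-identityˡ _)) convolution ⟩
    ballot j (suc n) + ballot (suc (suc j)) n ∎
    where
    convolution : ∑[ i ≤ n ] (c (suc i) * ballot j (n ∸ i)) ≡ ballot (suc (suc j)) n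
    convolution = begin
      ∑[ i ≤ n ] (c (suc i) * ballot j (n ∸ i))
        ≡⟨ ∑-cong n (λ i _ → trans (cong (_* ballot j (n ∸ i)) (c-suc i)) (*-distribʳ-∑ i _ _)) ⟩
      ∑[ i ≤ n ] ∑[ a ≤ i ] (c a * c (i ∸ a) * ballot j (n ∸ i))
        ≡⟨ ∑-triangle n _ ⟩
      ∑[ a ≤ n ] ∑[ b ≤ n ∸ a ] (c a * c (a + b ∸ a) * ballot j (n ∸ (a + b)))
        ≡⟨ ∑-cong n (λ a _ → ∑-cong (n ∸ a) (λ b _ → begin
             c a * c (a + b ∸ a) * ballot j (n ∸ (a + b))
               ≡⟨ cong₂ (λ u v → c a * c u * ballot j v) (ℕₚ.m+n∸m≡n a b) (sym (ℕₚ.∸-+-assoc n a b)) ⟩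
             c a * c b * ballot j (n ∸ a ∸ b)
               ≡⟨ ℕₚ.*-assoc (c a) (c b) _ ⟩
             c a * (c b * ballot j (n ∸ a ∸ b)) ∎)) ⟩
      ∑[ a ≤ n ] ∑[ b ≤ n ∸ a ] (c a * (c b * ballot j (n ∸ a ∸ b)))
        ≡⟨ ∑-cong n (λ a _ → sym (*-distribˡ-∑ (n ∸ a) (c a) _)) ⟩
      ballot (suc (suc j)) n ∎

  -- The ballot-number formula [zⁿ⁺¹] Cʲ = binom(2n+1+j, n+1) − binom(2n+1+j, n), kept free of subtraction.
  ballot-binomial : ∀ n j → ballot j (suc n) + (j + suc (n + n)) C n ≡ (j + suc (n + n)) C suc n
  ballot-binomial n zero = begin
    suc (n + n) C n                  ≡⟨ cong (suc (n + n) C_) (sym (ℕₚ.m+n∸m≡n n n)) ⟩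
    suc (n + n) C (n + n ∸ n)        ≡⟨ sym (nCk≡nC[n∸k] (s≤s (ℕₚ.m≤m+n n n))) ⟩
    suc (n + n) C suc n              ∎
  ballot-binomial zero (suc j) = begin
    ballot (suc j) 1 + 1             ≡⟨ cong (_+ 1) (ballot-step j 0) ⟩
    ballot j 1 + ballot (2 + j) 0 + 1 ≡⟨ cong (λ t → ballot j 1 + t + 1) (ballot-zeroʳ (2 + j)) ⟩
    ballot j 1 + 1 + 1               ≡⟨ cong (_+ 1) (ballot-binomial zero j) ⟩
    (j + 1) C 1 + 1                  ≡⟨ ℕₚ.+-comm ((j + 1) C 1) 1 ⟩
    1 + (j + 1) C 1                  ≡⟨ nCk+nC[k+1]≡[n+1]C[k+1] (j + 1) 0 ⟩
    suc (j + 1) C 1                  ∎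
  ballot-binomial (suc n) (suc j) = begin
    ballot (suc j) (2 + n) + suc N C suc n
      ≡⟨ cong₂ _+_ (ballot-step j (suc n)) (sym (nCk+nC[k+1]≡[n+1]C[k+1] N n)) ⟩
    (ballot j (2 + n) + ballot (2 + j) (suc n)) + (N C n + N C suc n)
      ≡⟨ regroup (ballot j (2 + n)) (ballot (2 + j) (suc n)) (N C n) (N C suc n) ⟩
    (ballot j (2 + n) + N C suc n) + (ballot (2 + j) (suc n) + N C n)
      ≡⟨ cong₂ _+_ (ballot-binomial (suc n) j) lower ⟩
    N C (2 + n) + N C suc n
      ≡⟨ ℕₚ.+-comm (N C (2 + n)) (N C suc n) ⟩
    N C suc n + N C (2 + n)
      ≡⟨ nCk+nC[k+1]≡[n+1]C[k+1] N (suc n) ⟩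
    suc N C (2 + n) ∎
    where
    N : ℕ
    N = j + suc (suc n + suc n)
    regroup : ∀ a b x y → (a + b) + (x + y) ≡ (a + y) + (b + x)
    regroup = solve-∀
    N≡ : ∀ j n → (2 + j) + suc (n + n) ≡ j + suc (suc n + suc n)
    N≡ = solve-∀
    lower : ballot (2 + j) (suc n) + N C n ≡ N C suc n
    lower = subst (λ M → ballot (2 + j) (suc n) + M C n ≡ M C suc n) (N≡ j n) (ballot-binomial n (2 + j))

  binomial-factorials : ∀ {n k} → k ≤ n → (n C k) * (k ! * (n ∸ k) !) ≡ n !
  binomial-factorials {n} {k} k≤n = begin
    (n C k) * D    ≡⟨ cong (_* D) (nCk≡n!/k![n-k]! k≤n) ⟩
    (n ! / D) * D  ≡⟨ ℕₚ.*-comm (n ! / D) D ⟩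
    D * (n ! / D)  ≡⟨ m*[n/m]≡n (k![n∸k]!∣n! k≤n) ⟩
    n !            ∎
    where
    D : ℕ
    D = k ! * (n ∸ k) !
    instance
      D≢0 : NonZero D
      D≢0 = ℕₚ._!*_!≢0 k (n ∸ k)

  binomial-absorption : ∀ k r → suc k * ((k + suc r) C suc k) ≡ suc r * ((k + suc r) C k)
  binomial-absorption k r = ℕₚ.*-cancelʳ-≡ _ _ (k ! * r !) ⦃ ℕₚ._!*_!≢0 k r ⦄ (begin
    suc k * X * (k ! * r !)              ≡⟨ shuffleˡ (suc k) X (k !) (r !) ⟩
    X * (suc k ! * r !)                  ≡⟨ cong (λ t → X * (suc k ! * t !)) (sym N∸1+k≡r) ⟩
    X * (suc k ! * (N ∸ suc k) !)        ≡⟨ binomial-factorials (subst (suc k ≤_) (sym (ℕₚ.+-suc k r)) (ℕₚ.m≤m+n (suc k) r)) ⟩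
    N !                                  ≡⟨ sym (binomial-factorials (ℕₚ.m≤m+n k (suc r))) ⟩
    Y * (k ! * (N ∸ k) !)                ≡⟨ cong (λ t → Y * (k ! * t !)) (ℕₚ.m+n∸m≡n k (suc r)) ⟩
    Y * (k ! * suc r !)                  ≡⟨ shuffleʳ (suc r) Y (k !) (r !) ⟩
    suc r * Y * (k ! * r !)              ∎)
    where
    N X Y : ℕ
    N = k + suc r
    X = N C suc k
    Y = N C k
    N∸1+k≡r : N ∸ suc k ≡ r
    N∸1+k≡r = trans (cong (_∸ suc k) (ℕₚ.+-suc k r)) (ℕₚ.m+n∸m≡n k r)
    shuffleˡ : ∀ a x f g → a * x * (f * g) ≡ x * ((a * f) * g)
    shuffleˡ = solve-∀
    shuffleʳ : ∀ a y f g → y * (f * (a * g)) ≡ a * y * (f * g)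
    shuffleʳ = solve-∀

  c≡catalan : ∀ n → c n ≡ catalan n
  c≡catalan zero    = c-zero
  c≡catalan (suc k) = sym (begin
    ((2 * suc k) C suc k) / suc (suc k)      ≡⟨ cong (λ t → (t C suc k) / suc (suc k)) 2[1+k]≡M ⟩
    X / suc (suc k)                          ≡⟨ cong (_/ suc (suc k)) (sym c*[2+k]≡X) ⟩
    (c (suc k) * suc (suc k)) / suc (suc k)  ≡⟨ m*n/n≡m (c (suc k)) (suc (suc k)) ⟩
    c (suc k)                                ∎)
    where
    M X Y : ℕ
    M = k + suc (suc k)
    X = M C suc k
    Y = M C k
    2[1+k]≡M : 2 * suc k ≡ M
    2[1+k]≡M = arith k
      where arith : ∀ k → 2 * suc k ≡ k + suc (suc k)
            arith = solve-∀
    c+Y≡X : c (suc k) + Y ≡ X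
    c+Y≡X = subst (λ t → c (suc k) + t C k ≡ t C suc k) (arith k)
                  (trans (cong (_+ _) (sym (ballot-one (suc k)))) (ballot-binomial k 1))
      where arith : ∀ k → 1 + suc (k + k) ≡ k + suc (suc k)
            arith = solve-∀
    c*[2+k]≡X : c (suc k) * suc (suc k) ≡ X
    c*[2+k]≡X = ℕₚ.+-cancelʳ-≡ (suc k * X) _ _ (begin
      c (suc k) * suc (suc k) + suc k * X          ≡⟨ cong (_+_ (c (suc k) * suc (suc k))) (binomial-absorption k (suc k)) ⟩
      c (suc k) * suc (suc k) + suc (suc k) * Y    ≡⟨ factor (c (suc k)) (suc (suc k)) Y ⟩
      suc (suc k) * (c (suc k) + Y)                ≡⟨ cong (suc (suc k) *_) c+Y≡X ⟩
      suc (suc k) * X                              ∎)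
      where factor : ∀ a m y → a * m + m * y ≡ m * (a + y)
            factor = solve-∀


private
  variable
    A B C : Set

⊆-map⁻ : ∀ (f : A → B) {xs} ys → xs ⊆ map f ys → ∃ λ xs′ → xs′ ⊆ ys × xs ≡ map f xs′
⊆-map⁻ f []       []         = [] , [] , refl
⊆-map⁻ f (y ∷ ys) (_ ∷ʳ p)   = let xs′ , q , eq = ⊆-map⁻ f ys p in xs′ , y ∷ʳ q , eq
⊆-map⁻ f (y ∷ ys) (refl ∷ p) = let xs′ , q , eq = ⊆-map⁻ f ys p in y ∷ xs′ , refl ∷ q , cong (f y ∷_) eq

⊆-++⁻ : ∀ {xs : List A} ys {zs} → xs ⊆ ys ++ zs → ∃₂ λ xs₁ xs₂ → xs ≡ xs₁ ++ xs₂ × xs₁ ⊆ ys × xs₂ ⊆ zs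
⊆-++⁻ []       p          = [] , _ , refl , [] , p
⊆-++⁻ (y ∷ ys) (_ ∷ʳ p)   = let xs₁ , xs₂ , eq , p₁ , p₂ = ⊆-++⁻ ys p in
                              xs₁ , xs₂ , eq , y ∷ʳ p₁ , p₂
⊆-++⁻ (y ∷ ys) (refl ∷ p) = let xs₁ , xs₂ , eq , p₁ , p₂ = ⊆-++⁻ ys p in
                              y ∷ xs₁ , xs₂ , cong (y ∷_) eq , refl ∷ p₁ , p₂

Unique-++⁻ : ∀ (xs : List A) {ys} → Unique (xs ++ ys) → Unique xs × Unique ys × Disjoint xs ys
Unique-++⁻ []       uys         = [] , uys , λ ()
Unique-++⁻ (x ∷ xs) (x∉ ∷ uxys) =
  let uxs , uys , xs∩ys = Unique-++⁻ xs uxys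
      x∉xs , x∉ys      = Allₚ.++⁻ xs x∉
  in x∉xs ∷ uxs , uys , λ { (here refl , x∈ys)  → All.lookup x∉ys x∈ys refl
                         ; (there v∈xs , v∈ys) → xs∩ys (v∈xs , v∈ys) }

++-∷-injective : ∀ {v : A} xs xs′ {ys ys′} → v ∉ xs → v ∉ xs′ →
                 xs ++ v ∷ ys ≡ xs′ ++ v ∷ ys′ → xs ≡ xs′ × ys ≡ ys′
++-∷-injective []       []        _    _     eq = refl , Listₚ.∷-injectiveʳ eq
++-∷-injective []       (x′ ∷ _)  _    v∉xs′ eq = contradiction (here (Listₚ.∷-injectiveˡ eq)) v∉xs′
++-∷-injective (x ∷ _)  []        v∉xs _     eq = contradiction (here (sym (Listₚ.∷-injectiveˡ eq))) v∉xs
++-∷-injective (x ∷ xs) (x′ ∷ xs′) v∉xs v∉xs′ eq =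
  let xs≡ , ys≡ = ++-∷-injective xs xs′ (v∉xs ∘ there) (v∉xs′ ∘ there) (Listₚ.∷-injectiveʳ eq)
  in cong₂ _∷_ (Listₚ.∷-injectiveˡ eq) xs≡ , ys≡

length≤-⊆ : ∀ {xs ys : List A} → Unique xs → (∀ {x} → x ∈ xs → x ∈ ys) → length xs ≤ length ys
length≤-⊆ {xs = []}     _            _     = z≤n
length≤-⊆ {xs = x ∷ xs} (x∉xs ∷ uxs) xs⊆ys with ∈-∃++ (xs⊆ys (here refl))
... | ys₁ , ys₂ , refl =
  ℕₚ.≤-trans (s≤s (length≤-⊆ uxs xs⊆ys₁++ys₂)) (ℕₚ.≤-reflexive (sym (Listₚ.length-++-sucʳ ys₁ x ys₂)))
  where
  xs⊆ys₁++ys₂ : ∀ {z} → z ∈ xs → z ∈ ys₁ ++ ys₂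
  xs⊆ys₁++ys₂ z∈xs with ∈-++⁻ ys₁ (xs⊆ys (there z∈xs))
  ... | inj₁ z∈ys₁         = ∈-++⁺ˡ z∈ys₁
  ... | inj₂ (here z≡x)    = contradiction (sym z≡x) (All.lookup x∉xs z∈xs)
  ... | inj₂ (there z∈ys₂) = ∈-++⁺ʳ ys₁ z∈ys₂

Unique-concatMap : ∀ (f : A → List B) {xs} → Unique xs → (∀ {x} → x ∈ xs → Unique (f x)) →
                   (∀ {x y z} → x ∈ xs → y ∈ xs → z ∈ f x → z ∈ f y → x ≡ y) → Unique (concatMap f xs)
Unique-concatMap f {xs = []}     _            _    _    = []
Unique-concatMap f {xs = x ∷ xs} (x∉xs ∷ uxs) uf   same =
  Uniqueₚ.++⁺ (uf (here refl)) (Unique-concatMap f uxs (uf ∘ there) (λ p q → same (there p) (there q))) disjoint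
  where
  disjoint : Disjoint (f x) (concatMap f xs)
  disjoint (z∈fx , z∈rest) = let y , y∈xs , z∈fy = find (∈-concatMap⁻ f z∈rest) in
    All.lookup x∉xs y∈xs (same (here refl) (there y∈xs) z∈fx z∈fy)

T-not : ∀ {b} → T (not b) ⇔ (¬ T b)
T-not {false} = mk⇔ (λ _ ()) (λ _ → _)
T-not {true}  = mk⇔ (λ ()) (λ ¬t → ¬t _)

<ᵇ≡true : ∀ {m n} → m < n → (m ℕ.<ᵇ n) ≡ true
<ᵇ≡true {m} {n} = dec-true (m ℕₚ.<? n)

<ᵇ≡false : ∀ {m n} → ¬ m < n → (m ℕ.<ᵇ n) ≡ false
<ᵇ≡false {m} {n} = dec-false (m ℕₚ.<? n)

≡ᵇ-cong-⇔ : ∀ {m n m′ n′} → (m ≡ n ⇔ m′ ≡ n′) → (m ℕ.≡ᵇ n) ≡ (m′ ℕ.≡ᵇ n′)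
≡ᵇ-cong-⇔ {m} {n} {m′} {n′} eq = does-⇔ eq (m ℕₚ.≟ n) (m′ ℕₚ.≟ n′)

≡ᵇ-+-cancelˡ : ∀ k x y → (k ℕ.+ x ℕ.≡ᵇ k ℕ.+ y) ≡ (x ℕ.≡ᵇ y)
≡ᵇ-+-cancelˡ zero    x y = refl
≡ᵇ-+-cancelˡ (suc k) x y = ≡ᵇ-+-cancelˡ k x y

T-elemᵇ : ∀ a as → T (elemᵇ a as) ⇔ a ∈ as
T-elemᵇ a as = mk⇔ (to as) from
  where
  to : ∀ as → T (elemᵇ a as) → a ∈ as
  to (b ∷ bs) t with Equivalence.to T-∨ t
  ... | inj₁ a≡ᵇb   = here (ℕₚ.≡ᵇ⇒≡ a b a≡ᵇb)
  ... | inj₂ a∈ᵇbs  = there (to bs a∈ᵇbs)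
  from : ∀ {as} → a ∈ as → T (elemᵇ a as)
  from {b ∷ _} (here a≡b)  = Equivalence.from T-∨ (inj₁ (ℕₚ.≡⇒≡ᵇ a b a≡b))
  from (there a∈bs)        = Equivalence.from T-∨ (inj₂ (from a∈bs))

T-distinctᵇ : ∀ π → T (distinctᵇ π) ⇔ Unique π
T-distinctᵇ π = mk⇔ (to π) from
  where
  to : ∀ π → T (distinctᵇ π) → Unique π
  to []       _ = []
  to (a ∷ as) t = let a∉ᵇas , as-distinct = Equivalence.to T-∧ t in
    Allₚ.¬Any⇒All¬ as (Equivalence.to T-not a∉ᵇas ∘ Equivalence.from (T-elemᵇ a as)) ∷ to as as-distinct
  from : ∀ {π} → Unique π → T (distinctᵇ π)
  from []                     = _
  from {a ∷ as} (a∉as ∷ uas)  = Equivalence.from T-∧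
    ( Equivalence.from T-not (λ a∈ᵇas → All.lookup a∉as (Equivalence.to (T-elemᵇ a as) a∈ᵇas) refl)
    , from uas)

-- 312-avoidance

σ312 : List ℕ
σ312 = 3 ∷ 1 ∷ 2 ∷ []

T-sameOrder312 : ∀ a b c → T (sameOrderᵇ (a ∷ b ∷ c ∷ []) σ312) ⇔ (b < c × c ≤ a)
T-sameOrder312 a b c = mk⇔ to from
  where
  to : T (sameOrderᵇ (a ∷ b ∷ c ∷ []) σ312) → b < c × c ≤ a
  to t with a ℕ.<ᵇ b | a ℕ.<ᵇ c in a<ᵇc | b ℕ.<ᵇ c in b<ᵇc
  ... | false | false | true = ℕₚ.<ᵇ⇒< b c (subst T (sym b<ᵇc) _) , ℕₚ.≮⇒≥ (λ a<c → subst T a<ᵇc (ℕₚ.<⇒<ᵇ a<c))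
  from : b < c × c ≤ a → T (sameOrderᵇ (a ∷ b ∷ c ∷ []) σ312)
  from (b<c , c≤a) rewrite <ᵇ≡false (ℕₚ.<⇒≯ (ℕₚ.<-≤-trans b<c c≤a)) | <ᵇ≡false (ℕₚ.≤⇒≯ c≤a) | <ᵇ≡true b<c = _

sameOrderᵇ-length : ∀ s σ → T (sameOrderᵇ s σ) → length s ≡ length σ
sameOrderᵇ-length []      []      _ = refl
sameOrderᵇ-length (a ∷ s) (b ∷ σ) t = cong suc (sameOrderᵇ-length s σ (proj₂ (Equivalence.to T-∧ t)))

∈-subseqs⇔ : ∀ π {s} → s ∈ subseqs π ⇔ s ⊆ π
∈-subseqs⇔ π = mk⇔ (to π) from
  where
  to : ∀ π {s} → s ∈ subseqs π → s ⊆ π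
  to []       (here refl) = []
  to (a ∷ as) s∈ with ∈-++⁻ (map (a ∷_) (subseqs as)) s∈
  ... | inj₂ s∈skip = a ∷ʳ to as s∈skip
  ... | inj₁ s∈keep with ∈-map⁻ (a ∷_) s∈keep
  ...   | t , t∈ , refl = refl ∷ to as t∈
  from : ∀ {π s} → s ⊆ π → s ∈ subseqs π
  from []                   = here refl
  from (_∷ʳ_ {ys = as} a p) = ∈-++⁺ʳ (map (a ∷_) (subseqs as)) (from p)
  from (refl ∷ p)           = ∈-++⁺ˡ (∈-map⁺ _ (from p))

-- An occurrence of 312 is a subsequence a b c with b < c ≤ a, exactly what sameOrderᵇ
-- accepts; on words with distinct letters this is the usual b < c < a.
data Contains312 (π : List ℕ) : Set where
  occurrence : ∀ {a b c} → a ∷ b ∷ c ∷ [] ⊆ π → b < c → c ≤ a → Contains312 π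

Avoids312 : List ℕ → Set
Avoids312 π = ¬ Contains312 π

T-containsᵇ312 : ∀ π → T (containsᵇ π σ312) ⇔ Contains312 π
T-containsᵇ312 π = mk⇔ to from
  where
  occurrence-of : ∀ {s} → s ∈ subseqs π → T (sameOrderᵇ s σ312) → length s ≡ 3 → Contains312 π
  occurrence-of {a ∷ b ∷ c ∷ []} s∈ t _ =
    let b<c , c≤a = Equivalence.to (T-sameOrder312 a b c) t in
    occurrence (Equivalence.to (∈-subseqs⇔ π) s∈) b<c c≤a
  to : T (containsᵇ π σ312) → Contains312 π
  to t = let s , s∈ , ts = find (any⁻ _ (subseqs π) t) in occurrence-of s∈ ts (sameOrderᵇ-length s σ312 ts)
  from : Contains312 π → T (containsᵇ π σ312)
  from (occurrence {a} {b} {c} abc⊆π b<c c≤a) =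
    any⁺ _ (lose (Equivalence.from (∈-subseqs⇔ π) abc⊆π) (Equivalence.from (T-sameOrder312 a b c) (b<c , c≤a)))

T-avoidsᵇ312 : ∀ π → T (avoidsᵇ π σ312) ⇔ Avoids312 π
T-avoidsᵇ312 π = mk⇔ (λ t → Equivalence.to T-not t ∘ Equivalence.from (T-containsᵇ312 π))
                     (λ avoids → Equivalence.from T-not (avoids ∘ Equivalence.to (T-containsᵇ312 π)))

Avoids312-⊆ : ∀ {xs ys} → xs ⊆ ys → Avoids312 ys → Avoids312 xs
Avoids312-⊆ xs⊆ys avoids (occurrence abc⊆xs b<c c≤a) = avoids (occurrence (⊆-trans abc⊆xs xs⊆ys) b<c c≤a)

Avoids312-map⁻ : ∀ {f : ℕ → ℕ} {xs} → (∀ {x y} → x < y → f x < f y) → (∀ {x y} → x ≤ y → f x ≤ f y) →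
                 Avoids312 (map f xs) → Avoids312 xs
Avoids312-map⁻ {f} f-< f-≤ avoids (occurrence abc⊆xs b<c c≤a) =
  avoids (occurrence (Sublistₚ.map⁺ f abc⊆xs) (f-< b<c) (f-≤ c≤a))

Avoids312-map⁺ : ∀ {f : ℕ → ℕ} {xs} → (∀ {x y} → f x < f y → x < y) → (∀ {x y} → f x ≤ f y → x ≤ y) →
                 Avoids312 xs → Avoids312 (map f xs)
Avoids312-map⁺ {f} {xs} f-<⁻ f-≤⁻ avoids (occurrence abc⊆fxs b<c c≤a) with ⊆-map⁻ f xs abc⊆fxs
... | _ ∷ _ ∷ _ ∷ [] , abc⊆xs , refl = avoids (occurrence abc⊆xs (f-<⁻ b<c) (f-≤⁻ c≤a))

Avoids312-∷ : ∀ {m R} → All (m ≤_) R → Avoids312 R → Avoids312 (m ∷ R)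
Avoids312-∷ m≤R avoids (occurrence (_ ∷ʳ abc⊆R) b<c c≤a)   = avoids (occurrence abc⊆R b<c c≤a)
Avoids312-∷ m≤R avoids (occurrence (refl ∷ bc⊆R) b<c c≤m) =
  ℕₚ.<-irrefl refl (ℕₚ.<-≤-trans (ℕₚ.≤-<-trans (All.lookup m≤R (to∈ bc⊆R)) b<c) c≤m)

-- The only 312 occurrences of L ++ R that are not inside L or R take the "3" from L and
-- the "2" from R; the side condition rules them out.
Avoids312-++ : ∀ {L R} → Avoids312 L → Avoids312 R →
               (∀ {x y z} → x ∈ L → y ∈ L ++ R → z ∈ R → y < z → x < z) → Avoids312 (L ++ R)
Avoids312-++ {L} {R} avoidsL avoidsR cross (occurrence abc⊆LR b<c c≤a) with ⊆-++⁻ L abc⊆LR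
... | [] , _ , refl , _ , abc⊆R                 = avoidsR (occurrence abc⊆R b<c c≤a)
... | _ ∷ [] , _ , refl , a⊆L , bc⊆R            =
  ℕₚ.<⇒≱ (cross (to∈ a⊆L) (∈-++⁺ʳ L (to∈ bc⊆R)) (to∈ (Sublistₚ.∷ˡ⁻ bc⊆R)) b<c) c≤a
... | _ ∷ _ ∷ [] , _ , refl , ab⊆L , c⊆R        =
  ℕₚ.<⇒≱ (cross (to∈ ab⊆L) (∈-++⁺ˡ (to∈ (Sublistₚ.∷ˡ⁻ ab⊆L))) (to∈ c⊆R) b<c) c≤a
... | _ ∷ _ ∷ _ ∷ [] , [] , refl , abc⊆L , _    = avoidsL (occurrence abc⊆L b<c c≤a)

Avoids312-shift : ∀ k {xs} → Avoids312 xs → Avoids312 (map (k ℕ.+_) xs)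
Avoids312-shift k = Avoids312-map⁺ (ℕₚ.+-cancelˡ-< k _ _) (ℕₚ.+-cancelˡ-≤ k _ _)

Avoids312-unshift : ∀ k {xs} → Avoids312 (map (k ℕ.+_) xs) → Avoids312 xs
Avoids312-unshift k = Avoids312-map⁻ (ℕₚ.+-monoʳ-< k) (ℕₚ.+-monoʳ-≤ k)

InRange : ℕ → ℕ → ℕ → Set
InRange lo hi v = lo ≤ v × v ≤ hi

range : ℕ → List ℕ
range n = map suc (upTo n)

∈-range⇔ : ∀ n {v} → v ∈ range n ⇔ InRange 1 n v
∈-range⇔ n = mk⇔ to from
  where
  to : ∀ {v} → v ∈ range n → InRange 1 n v
  to v∈ with ∈-map⁻ suc v∈
  ... | _ , i∈ , refl = s≤s z≤n , ∈-upTo⁻ i∈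
  from : ∀ {v} → InRange 1 n v → v ∈ range n
  from {suc i} (_ , i<n) = ∈-map⁺ suc (∈-upTo⁺ i<n)

Unique-range : ∀ n → Unique (range n)
Unique-range n = Uniqueₚ.map⁺ ℕₚ.suc-injective (Uniqueₚ.upTo⁺ n)

length-range : ∀ n → length (range n) ≡ n
length-range n = trans (Listₚ.length-map suc (upTo n)) (Listₚ.length-upTo n)

record IsPerm (n : ℕ) (π : List ℕ) : Set where
  field
    length≡ : length π ≡ n
    inRange : All (InRange 1 n) π
    unique  : Unique π

Perm312 : ℕ → List ℕ → Set
Perm312 n π = IsPerm n π × Avoids312 π

IsPerm⇒∈ : ∀ {n π v} → IsPerm n π → InRange 1 n v → v ∈ π
IsPerm⇒∈ {n} {π} {v} perm v-inRange with v ∈? π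
... | yes v∈π = v∈π
... | no  v∉π = contradiction v∷π-fits ℕₚ.1+n≰n
  where
  open IsPerm perm
  v∷π-fits : suc n ≤ n
  v∷π-fits = subst₂ (λ a b → suc a ≤ b) length≡ (length-range n)
    (length≤-⊆ (Allₚ.¬Any⇒All¬ π v∉π ∷ unique) λ
      { (here refl)  → Equivalence.from (∈-range⇔ n) v-inRange
      ; (there x∈π) → Equivalence.from (∈-range⇔ n) (All.lookup inRange x∈π) })

∈-wordsOver⁻ : ∀ vs k {w} → w ∈ wordsOver vs k → length w ≡ k × All (_∈ vs) w
∈-wordsOver⁻ vs zero    (here refl) = refl , []
∈-wordsOver⁻ vs (suc k) w∈ with find (∈-concatMap⁻ (λ v → map (v ∷_) (wordsOver vs k)) {vs} w∈)
... | v , v∈vs , w∈vW with ∈-map⁻ (v ∷_) w∈vW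
...   | w′ , w′∈ , refl = let length≡ , letters = ∈-wordsOver⁻ vs k w′∈ in cong suc length≡ , v∈vs ∷ letters

∈-wordsOver⁺ : ∀ vs {w} → All (_∈ vs) w → w ∈ wordsOver vs (length w)
∈-wordsOver⁺ vs []                          = here refl
∈-wordsOver⁺ vs (_∷_ {x = v} {xs = w} v∈vs letters) =
  ∈-concatMap⁺ (λ v → map (v ∷_) (wordsOver vs (length w))) (lose v∈vs (∈-map⁺ (v ∷_) (∈-wordsOver⁺ vs letters)))

Unique-wordsOver : ∀ {vs} k → Unique vs → Unique (wordsOver vs k)
Unique-wordsOver zero    _   = [] ∷ []
Unique-wordsOver {vs} (suc k) uvs = Unique-concatMap (λ v → map (v ∷_) (wordsOver vs k)) uvs
  (λ _ → Uniqueₚ.map⁺ Listₚ.∷-injectiveʳ (Unique-wordsOver k uvs)) same-head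
  where
  same-head : ∀ {x y z} → x ∈ vs → y ∈ vs → z ∈ map (x ∷_) (wordsOver vs k) → z ∈ map (y ∷_) (wordsOver vs k) → x ≡ y
  same-head _ _ z∈x z∈y with ∈-map⁻ (_ ∷_) z∈x | ∈-map⁻ (_ ∷_) z∈y
  ... | _ , _ , refl | _ , _ , z≡y∷ = Listₚ.∷-injectiveˡ z≡y∷

∈-Sym312⇔ : ∀ n {π} → π ∈ Sym312 n ⇔ Perm312 n π
∈-Sym312⇔ n {π} = mk⇔ to from
  where
  to : π ∈ Sym312 n → Perm312 n π
  to π∈ =
    let π∈Sym , avoids       = ∈-filter⁻ (T? ∘ λ π → avoidsᵇ π σ312) π∈
        π∈words , distinct   = ∈-filter⁻ (T? ∘ distinctᵇ) π∈Sym
        length≡ , letters    = ∈-wordsOver⁻ (range n) n π∈words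
    in record { length≡ = length≡
              ; inRange = All.map (Equivalence.to (∈-range⇔ n)) letters
              ; unique  = Equivalence.to (T-distinctᵇ π) distinct }
     , Equivalence.to (T-avoidsᵇ312 π) avoids
  from : Perm312 n π → π ∈ Sym312 n
  from (perm , avoids) = ∈-filter⁺ (T? ∘ λ π → avoidsᵇ π σ312)
    (∈-filter⁺ (T? ∘ distinctᵇ) π∈words (Equivalence.from (T-distinctᵇ π) unique))
    (Equivalence.from (T-avoidsᵇ312 π) avoids)
    where
    open IsPerm perm
    π∈words : π ∈ wordsOver (range n) n
    π∈words = subst (λ k → π ∈ wordsOver (range n) k) length≡
                    (∈-wordsOver⁺ (range n) (All.map (Equivalence.from (∈-range⇔ n)) inRange))

Unique-Sym312 : ∀ n → Unique (Sym312 n)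
Unique-Sym312 n = Uniqueₚ.filter⁺ _ (Uniqueₚ.filter⁺ _ (Unique-wordsOver n (Unique-range n)))

Sym312⇒length≡ : ∀ c {α} → α ∈ Sym312 c → length α ≡ c
Sym312⇒length≡ c = IsPerm.length≡ ∘ proj₁ ∘ Equivalence.to (∈-Sym312⇔ c)

Sym312⇒0∉ : ∀ c {α} → α ∈ Sym312 c → 0 ∉ α
Sym312⇒0∉ c α∈ 0∈α = ℕₚ.<-irrefl refl (proj₁ (All.lookup inRange 0∈α))
  where open IsPerm (proj₁ (Equivalence.to (∈-Sym312⇔ c) α∈))

InRange-shift : ∀ k {hi xs} → All (InRange 1 hi) xs → All (InRange (suc k) (k ℕ.+ hi)) (map (k ℕ.+_) xs)
InRange-shift k = Allₚ.map⁺ ∘ All.map λ {x} (1≤x , x≤hi) →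
  subst (_≤ k ℕ.+ x) (ℕₚ.+-comm k 1) (ℕₚ.+-monoʳ-≤ k 1≤x) , ℕₚ.+-monoʳ-≤ k x≤hi

InRange-unshift : ∀ k {hi xs} → All (InRange (suc k) (k ℕ.+ hi)) xs →
          map (k ℕ.+_) (map (_∸ k) xs) ≡ xs × All (InRange 1 hi) (map (_∸ k) xs)
InRange-unshift k []                       = refl , []
InRange-unshift k {hi} ((k<x , x≤k+hi) ∷ rest) =
  let xs≡ , rest-inRange = InRange-unshift k rest in
  cong₂ _∷_ (ℕₚ.m+[n∸m]≡n (ℕₚ.<⇒≤ k<x)) xs≡ ,
  (ℕₚ.m<n⇒0<n∸m k<x , subst (_ ∸ k ≤_) (ℕₚ.m+n∸m≡n k hi) (ℕₚ.∸-monoˡ-≤ k x≤k+hi)) ∷ rest-inRange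

-- Gluing

-- π = (α + 1) 1 (β + |α| + 1): the standard decomposition of a 312-avoiding permutation
-- around the position of its entry 1.
glue : List ℕ → List ℕ → List ℕ
glue α β = map suc α ++ 1 ∷ map (suc (length α) ℕ.+_) β

glue-injectiveʳ : ∀ α {β β′} → glue α β ≡ glue α β′ → β ≡ β′
glue-injectiveʳ α eq =
  Listₚ.map-injective (ℕₚ.+-cancelˡ-≡ (suc (length α)) _ _) (Listₚ.∷-injectiveʳ (Listₚ.++-cancelˡ (map suc α) _ _ eq))

glue-injectiveˡ : ∀ {α α′ β β′} → 0 ∉ α → 0 ∉ α′ → glue α β ≡ glue α′ β′ → α ≡ α′
glue-injectiveˡ {α} {α′} 0∉α 0∉α′ eq =
  Listₚ.map-injective ℕₚ.suc-injective (proj₁ (++-∷-injective (map suc α) (map suc α′) (1∉ 0∉α) (1∉ 0∉α′) eq))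
  where
  1∉ : ∀ {xs} → 0 ∉ xs → 1 ∉ map suc xs
  1∉ 0∉xs 1∈ with ∈-map⁻ suc 1∈
  ... | _ , 0∈xs , refl = 0∉xs 0∈xs

module _ {c d α β} (α-perm : IsPerm c α) (β-perm : IsPerm d β) where

  private
    module α = IsPerm α-perm
    module β = IsPerm β-perm
    L R : List ℕ
    L = map suc α
    R = map (suc (length α) ℕ.+_) β

    c≡ : length α ≡ c
    c≡ = α.length≡

    L-inRange : All (InRange 2 (suc c)) L
    L-inRange = InRange-shift 1 α.inRange

    R-inRange : All (InRange (suc (suc c)) (suc c ℕ.+ d)) R
    R-inRange rewrite c≡ = InRange-shift (suc c) β.inRange

    1∉R : All (1 ≢_) R
    1∉R = All.map (λ (2+c≤v , _) 1≡v → ℕₚ.<-irrefl 1≡v (ℕₚ.≤-trans (s≤s (s≤s z≤n)) 2+c≤v)) R-inRange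

    L∩1∷R : Disjoint L (1 ∷ R)
    L∩1∷R (v∈L , here refl)  = ℕₚ.<-irrefl refl (proj₁ (All.lookup L-inRange v∈L))
    L∩1∷R (v∈L , there v∈R) =
      ℕₚ.<-irrefl refl (ℕₚ.≤-<-trans (proj₂ (All.lookup L-inRange v∈L)) (proj₁ (All.lookup R-inRange v∈R)))

  glue-IsPerm : IsPerm (suc (c ℕ.+ d)) (glue α β)
  glue-IsPerm = record
    { length≡ = begin
        length (L ++ 1 ∷ R)            ≡⟨ Listₚ.length-++-sucʳ L 1 R ⟩
        suc (length (L ++ R))          ≡⟨ cong suc (Listₚ.length-++ L) ⟩
        suc (length L ℕ.+ length R)    ≡⟨ cong₂ (λ a b → suc (a ℕ.+ b)) (trans (Listₚ.length-map suc α) c≡)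
                                                                       (trans (Listₚ.length-map _ β) β.length≡) ⟩
        suc (c ℕ.+ d)                  ∎
    ; inRange = Allₚ.++⁺ (All.map (λ (2≤v , v≤1+c) → ℕₚ.≤-trans (s≤s z≤n) 2≤v , ℕₚ.≤-trans v≤1+c (s≤s (ℕₚ.m≤m+n c d))) L-inRange)
                        ((s≤s z≤n , s≤s z≤n) ∷ All.map (λ (2+c≤v , v≤) → ℕₚ.≤-trans (s≤s z≤n) 2+c≤v , v≤) R-inRange)
    ; unique  = Uniqueₚ.++⁺ (Uniqueₚ.map⁺ ℕₚ.suc-injective α.unique)
                            (1∉R ∷ Uniqueₚ.map⁺ (ℕₚ.+-cancelˡ-≡ _ _ _) β.unique) L∩1∷R
    }
    where open ≡-Reasoning

  -- A "2" taken from 1 ∷ R is never the entry 1 (nothing lies below it), so it exceeds all of L.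
  glue-Avoids312 : Avoids312 α → Avoids312 β → Avoids312 (glue α β)
  glue-Avoids312 α-avoids β-avoids = Avoids312-++ (Avoids312-shift 1 α-avoids)
    (Avoids312-∷ (All.map (λ (2+c≤v , _) → ℕₚ.≤-trans (s≤s z≤n) 2+c≤v) R-inRange) (Avoids312-shift (suc (length α)) β-avoids))
    cross
    where
    cross : ∀ {x y z} → x ∈ L → y ∈ L ++ 1 ∷ R → z ∈ 1 ∷ R → y < z → x < z
    cross _   y∈ (here refl) y<1 = contradiction y<1 (ℕₚ.≤⇒≯ (proj₁ (All.lookup (IsPerm.inRange glue-IsPerm) y∈)))
    cross x∈L _  (there z∈R) _   = ℕₚ.≤-<-trans (proj₂ (All.lookup L-inRange x∈L)) (proj₁ (All.lookup R-inRange z∈R))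

glue-Perm312 : ∀ {c d α β} → Perm312 c α → Perm312 d β → Perm312 (suc (c ℕ.+ d)) (glue α β)
glue-Perm312 (α-perm , α-avoids) (β-perm , β-avoids) =
  glue-IsPerm α-perm β-perm , glue-Avoids312 α-perm β-perm α-avoids β-avoids

module Decomposition {n} (pre suf : List ℕ) (perm : IsPerm (suc n) (pre ++ 1 ∷ suf))
                     (avoids : Avoids312 (pre ++ 1 ∷ suf)) where

  open IsPerm perm

  c d : ℕ
  c = length pre
  d = length suf

  c+d≡n : c ℕ.+ d ≡ n
  c+d≡n = ℕₚ.suc-injective (trans (cong suc (sym (Listₚ.length-++ pre))) (trans (sym (Listₚ.length-++-sucʳ pre 1 suf)) length≡))

  private
    pre-split : Unique pre × Unique (1 ∷ suf) × Disjoint pre (1 ∷ suf)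
    pre-split = Unique-++⁻ pre unique
    pre-unique : Unique pre
    pre-unique = proj₁ pre-split
    1∷suf-unique : Unique (1 ∷ suf)
    1∷suf-unique = proj₁ (proj₂ pre-split)
    pre∩1∷suf : Disjoint pre (1 ∷ suf)
    pre∩1∷suf = proj₂ (proj₂ pre-split)

    inRange-pre : ∀ {x} → x ∈ pre → InRange 1 (suc n) x
    inRange-pre = All.lookup inRange ∘ ∈-++⁺ˡ

    inRange-suf : ∀ {y} → y ∈ suf → InRange 1 (suc n) y
    inRange-suf = All.lookup inRange ∘ ∈-++⁺ʳ pre ∘ there

    ≥2 : ∀ {v} → 1 ≤ v → 1 ≢ v → 2 ≤ v
    ≥2 {suc zero}    _ 1≢1 = contradiction refl 1≢1
    ≥2 {suc (suc _)} _ _   = s≤s (s≤s z≤n)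

    pre-≥2 : ∀ {x} → x ∈ pre → 2 ≤ x
    pre-≥2 x∈pre = ≥2 (proj₁ (inRange-pre x∈pre)) (λ { refl → pre∩1∷suf (x∈pre , here refl) })

    suf-≥2 : ∀ {y} → y ∈ suf → 2 ≤ y
    suf-≥2 {y} y∈suf = ≥2 (proj₁ (inRange-suf y∈suf)) (λ { refl → All.lookup (AllPairs.head 1∷suf-unique) y∈suf refl })

  -- Otherwise x 1 y would be an occurrence of 312.
  pre<suf : ∀ {x y} → x ∈ pre → y ∈ suf → x < y
  pre<suf {x} {y} x∈pre y∈suf with ℕₚ.<-cmp x y
  ... | tri< x<y _ _ = x<y
  ... | tri≈ _ refl _ = contradiction (x∈pre , there y∈suf) pre∩1∷suf
  ... | tri> _ _ y<x =
    contradiction (occurrence (Sublistₚ.++⁺ (from∈ x∈pre) (refl ∷ from∈ y∈suf)) (suf-≥2 y∈suf) (ℕₚ.<⇒≤ y<x)) avoids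

  -- 1, …, x all occur in π and none of them in suf, so they fit into 1 ∷ pre.
  pre-≤ : ∀ {x} → x ∈ pre → x ≤ suc c
  pre-≤ {x} x∈pre = subst (_≤ suc c) (length-range x) (length≤-⊆ (Unique-range x) range⊆1∷pre)
    where
    range⊆1∷pre : ∀ {v} → v ∈ range x → v ∈ 1 ∷ pre
    range⊆1∷pre v∈range with Equivalence.to (∈-range⇔ x) v∈range
    ... | 1≤v , v≤x with ∈-++⁻ pre (IsPerm⇒∈ perm (1≤v , ℕₚ.≤-trans v≤x (proj₂ (inRange-pre x∈pre))))
    ...   | inj₁ v∈pre         = there v∈pre
    ...   | inj₂ (here v≡1)    = here v≡1
    ...   | inj₂ (there v∈suf) = contradiction (pre<suf x∈pre v∈suf) (ℕₚ.≤⇒≯ v≤x)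

  -- y, 1 and all of pre are distinct values in 1 … y.
  suf-≥ : ∀ {y} → y ∈ suf → suc (suc c) ≤ y
  suf-≥ {y} y∈suf = subst (suc (suc c) ≤_) (length-range y) (length≤-⊆ y∷1∷pre-unique y∷1∷pre⊆range)
    where
    y∉1∷pre : All (y ≢_) (1 ∷ pre)
    y∉1∷pre = (λ y≡1 → ℕₚ.<-irrefl (sym y≡1) (suf-≥2 y∈suf))
            ∷ All.tabulate (λ x∈pre y≡x → ℕₚ.<-irrefl (sym y≡x) (pre<suf x∈pre y∈suf))
    y∷1∷pre-unique : Unique (y ∷ 1 ∷ pre)
    y∷1∷pre-unique = y∉1∷pre ∷ All.tabulate (λ x∈pre 1≡x → pre∩1∷suf (x∈pre , here (sym 1≡x))) ∷ pre-unique
    y∷1∷pre⊆range : ∀ {v} → v ∈ y ∷ 1 ∷ pre → v ∈ range y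
    y∷1∷pre⊆range (here refl)          = Equivalence.from (∈-range⇔ y) (proj₁ (inRange-suf y∈suf) , ℕₚ.≤-refl)
    y∷1∷pre⊆range (there (here refl))  = Equivalence.from (∈-range⇔ y) (ℕₚ.≤-refl , proj₁ (inRange-suf y∈suf))
    y∷1∷pre⊆range (there (there x∈pre)) =
      Equivalence.from (∈-range⇔ y) (proj₁ (inRange-pre x∈pre) , ℕₚ.<⇒≤ (pre<suf x∈pre y∈suf))

  α β : List ℕ
  α = map (_∸ 1) pre
  β = map (_∸ suc c) suf

  private
    α-unshift : map suc α ≡ pre × All (InRange 1 c) α
    α-unshift = InRange-unshift 1 (All.tabulate (λ x∈pre → pre-≥2 x∈pre , pre-≤ x∈pre))
    β-unshift : map (suc c ℕ.+_) β ≡ suf × All (InRange 1 d) β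
    β-unshift = InRange-unshift (suc c) {d} (All.tabulate λ {y} y∈suf →
      suf-≥ y∈suf , subst (y ≤_) (cong suc (sym c+d≡n)) (proj₂ (inRange-suf y∈suf)))

  α-Perm312 : Perm312 c α
  α-Perm312 = record
    { length≡ = Listₚ.length-map _ pre
    ; inRange = proj₂ α-unshift
    ; unique  = Uniqueₚ.map⁻ (subst Unique (sym (proj₁ α-unshift)) pre-unique)
    } , Avoids312-unshift 1
          (subst Avoids312 (sym (proj₁ α-unshift)) (Avoids312-⊆ (Sublistₚ.++⁺ʳ (1 ∷ suf) ⊆-refl) avoids))

  β-Perm312 : Perm312 d β
  β-Perm312 = record
    { length≡ = Listₚ.length-map _ suf
    ; inRange = proj₂ β-unshift
    ; unique  = Uniqueₚ.map⁻ (subst Unique (sym (proj₁ β-unshift)) (AllPairs.tail 1∷suf-unique))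
    } , Avoids312-unshift (suc c)
          (subst Avoids312 (sym (proj₁ β-unshift)) (Avoids312-⊆ (Sublistₚ.++⁺ˡ pre (1 ∷ʳ ⊆-refl)) avoids))

  π≡glue : pre ++ 1 ∷ suf ≡ glue α β
  π≡glue = sym (cong₂ (λ xs ys → xs ++ 1 ∷ ys) (proj₁ α-unshift)
                      (trans (cong (λ k → map (suc k ℕ.+_) β) (Listₚ.length-map _ pre)) (proj₁ β-unshift)))

gluingsAt : ℕ → ℕ → List (List ℕ)
gluingsAt n c = concatMap (λ α → map (glue α) (Sym312 (n ∸ c))) (Sym312 c)

gluings : ℕ → List (List ℕ)
gluings n = concatMap (gluingsAt n) (upTo (suc n))

∈-gluingsAt⁻ : ∀ n c {π} → π ∈ gluingsAt n c → ∃₂ λ α β → α ∈ Sym312 c × β ∈ Sym312 (n ∸ c) × π ≡ glue α β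
∈-gluingsAt⁻ n c π∈ with find (∈-concatMap⁻ (λ α → map (glue α) (Sym312 (n ∸ c))) {Sym312 c} π∈)
... | α , α∈ , π∈α with ∈-map⁻ (glue α) π∈α
...   | β , β∈ , π≡ = α , β , α∈ , β∈ , π≡

∈-gluings⇔ : ∀ n {π} → π ∈ gluings n ⇔ π ∈ Sym312 (suc n)
∈-gluings⇔ n {π} = mk⇔ to from
  where
  to : π ∈ gluings n → π ∈ Sym312 (suc n)
  to π∈ with find (∈-concatMap⁻ (gluingsAt n) {upTo (suc n)} π∈)
  ... | c , c∈ , π∈c with ∈-gluingsAt⁻ n c π∈c
  ...   | α , β , α∈ , β∈ , refl = Equivalence.from (∈-Sym312⇔ (suc n))
    (subst (λ k → Perm312 (suc k) (glue α β)) (ℕₚ.m+[n∸m]≡n (ℕₚ.≤-pred (∈-upTo⁻ c∈)))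
           (glue-Perm312 (Equivalence.to (∈-Sym312⇔ c) α∈) (Equivalence.to (∈-Sym312⇔ (n ∸ c)) β∈)))
  from : π ∈ Sym312 (suc n) → π ∈ gluings n
  from π∈ with Equivalence.to (∈-Sym312⇔ (suc n)) π∈
  ... | perm , avoids with ∈-∃++ (IsPerm⇒∈ perm (s≤s z≤n , s≤s z≤n))
  ...   | pre , suf , refl =
    ∈-concatMap⁺ (gluingsAt n) (lose (∈-upTo⁺ (s≤s c≤n))
      (∈-concatMap⁺ (λ α → map (glue α) (Sym312 (n ∸ c)))
        (lose α∈ (subst (_∈ map (glue α) (Sym312 (n ∸ c))) (sym π≡glue) (∈-map⁺ (glue α) β∈)))))
    where
    open Decomposition pre suf perm avoids
    c≤n : c ≤ n
    c≤n = subst (c ≤_) c+d≡n (ℕₚ.m≤m+n c d)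
    α∈ : α ∈ Sym312 c
    α∈ = Equivalence.from (∈-Sym312⇔ c) α-Perm312
    β∈ : β ∈ Sym312 (n ∸ c)
    β∈ = Equivalence.from (∈-Sym312⇔ (n ∸ c)) (subst (λ k → Perm312 k β) n∸c≡d β-Perm312)
      where
      n∸c≡d : d ≡ n ∸ c
      n∸c≡d = sym (trans (cong (_∸ c) (sym c+d≡n)) (ℕₚ.m+n∸m≡n c d))

Unique-gluings : ∀ n → Unique (gluings n)
Unique-gluings n = Unique-concatMap (gluingsAt n) (Uniqueₚ.upTo⁺ (suc n)) (λ {c} _ → Unique-gluingsAt c) same-size
  where
  Unique-gluingsAt : ∀ c → Unique (gluingsAt n c)
  Unique-gluingsAt c = Unique-concatMap (λ α → map (glue α) (Sym312 (n ∸ c))) (Unique-Sym312 c)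
    (λ {α} _ → Uniqueₚ.map⁺ (glue-injectiveʳ α) (Unique-Sym312 (n ∸ c))) same-α
    where
    same-α : ∀ {α α′ π} → α ∈ Sym312 c → α′ ∈ Sym312 c →
             π ∈ map (glue α) (Sym312 (n ∸ c)) → π ∈ map (glue α′) (Sym312 (n ∸ c)) → α ≡ α′
    same-α {α} {α′} α∈ α′∈ π∈ π∈′ with ∈-map⁻ (glue α) π∈ | ∈-map⁻ (glue α′) π∈′
    ... | _ , _ , refl | _ , _ , π≡ = glue-injectiveˡ (Sym312⇒0∉ c α∈) (Sym312⇒0∉ c α′∈) π≡
  same-size : ∀ {c c′ π} → c ∈ upTo (suc n) → c′ ∈ upTo (suc n) → π ∈ gluingsAt n c → π ∈ gluingsAt n c′ → c ≡ c′
  same-size {c} {c′} _ _ π∈ π∈′ with ∈-gluingsAt⁻ n c π∈ | ∈-gluingsAt⁻ n c′ π∈′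
  ... | α , _ , α∈ , _ , refl | α′ , _ , α′∈ , _ , π≡ =
    trans (sym (Sym312⇒length≡ c α∈))
          (trans (cong length (glue-injectiveˡ (Sym312⇒0∉ c α∈) (Sym312⇒0∉ c′ α′∈) π≡)) (Sym312⇒length≡ c′ α′∈))

Sym312-suc↭gluings : ∀ n → Sym312 (suc n) ↭ gluings n
Sym312-suc↭gluings n = ∼bag⇒↭ (unique∧set⇒bag (Unique-Sym312 (suc n)) (Unique-gluings n)
                                               (⇔.sym (∈-gluings⇔ n)))

open ℕΣ

toℕ : Bool → ℕ
toℕ b = if b then 1 else 0

count : (A → Bool) → List A → ℕ
count p xs = length (filterᵇ p xs)

count-∷ : ∀ (p : A → Bool) x xs → count p (x ∷ xs) ≡ toℕ (p x) ℕ.+ count p xs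
count-∷ p x xs with p x
... | true  = refl
... | false = refl

count-++ : ∀ (p : A → Bool) xs ys → count p (xs ++ ys) ≡ count p xs ℕ.+ count p ys
count-++ p xs ys = trans (cong length (Listₚ.filter-++ (T? ∘ p) xs ys)) (Listₚ.length-++ (filterᵇ p xs))

count-cong : ∀ {p q : A → Bool} xs → (∀ {x} → x ∈ xs → p x ≡ q x) → count p xs ≡ count q xs
count-cong                 []       _   = refl
count-cong {p = p} {q = q} (x ∷ xs) p≗q = begin
  count p (x ∷ xs)                ≡⟨ count-∷ p x xs ⟩
  toℕ (p x) ℕ.+ count p xs        ≡⟨ cong₂ (λ b n → toℕ b ℕ.+ n) (p≗q (here refl)) (count-cong xs (p≗q ∘ there)) ⟩
  toℕ (q x) ℕ.+ count q xs        ≡⟨ sym (count-∷ q x xs) ⟩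
  count q (x ∷ xs)                ∎
  where open ≡-Reasoning

count-false : ∀ (xs : List A) → count (λ _ → false) xs ≡ 0
count-false []       = refl
count-false (_ ∷ xs) = count-false xs

count-true : ∀ (xs : List A) → count (λ _ → true) xs ≡ length xs
count-true []       = refl
count-true (_ ∷ xs) = cong suc (count-true xs)

count-↭ : ∀ (p : A → Bool) {xs ys} → xs ↭ ys → count p xs ≡ count p ys
count-↭ p xs↭ys = ↭-length (filter-↭ (T? ∘ p) xs↭ys)

count-map : ∀ (p : A → Bool) (f : B → A) xs → count p (map f xs) ≡ count (p ∘ f) xs
count-map p f []       = refl
count-map p f (x ∷ xs) = begin
  count p (f x ∷ map f xs)             ≡⟨ count-∷ p (f x) (map f xs) ⟩
  toℕ (p (f x)) ℕ.+ count p (map f xs) ≡⟨ cong (toℕ (p (f x)) ℕ.+_) (count-map p f xs) ⟩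
  toℕ (p (f x)) ℕ.+ count (p ∘ f) xs   ≡⟨ sym (count-∷ (p ∘ f) x xs) ⟩
  count (p ∘ f) (x ∷ xs)               ∎
  where open ≡-Reasoning

count-concatMap-applyUpTo : ∀ (p : A → Bool) (f : B → List A) (g : ℕ → B) n →
                          count p (concatMap f (applyUpTo g (suc n))) ≡ ∑[ k ≤ n ] count p (f (g k))
count-concatMap-applyUpTo p f g zero    = trans (count-++ p (f (g 0)) []) (ℕₚ.+-identityʳ _)
count-concatMap-applyUpTo p f g (suc n) = begin
  count p (f (g 0) ++ concatMap f (applyUpTo (g ∘ suc) (suc n)))    ≡⟨ count-++ p (f (g 0)) _ ⟩
  count p (f (g 0)) ℕ.+ count p (concatMap f (applyUpTo (g ∘ suc) (suc n)))
                                                                   ≡⟨ cong (count p (f (g 0)) ℕ.+_) (count-concatMap-applyUpTo p f (g ∘ suc) n) ⟩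
  count p (f (g 0)) ℕ.+ ∑[ k ≤ n ] count p (f (g (suc k)))          ≡⟨ sym (∑-head n _) ⟩
  ∑[ k ≤ suc n ] count p (f (g k))                                 ∎
  where open ≡-Reasoning

count-+-shift : ∀ (h : B → ℕ) s i ys →
                count (λ y → s ℕ.+ h y ℕ.≡ᵇ i) ys ≡ ∑[ a ≤ i ] (toℕ (s ℕ.≡ᵇ a) ℕ.* count (λ y → h y ℕ.≡ᵇ i ∸ a) ys)
count-+-shift h s i ys with s ℕₚ.≤? i
... | yes s≤i = begin
  count (λ y → s ℕ.+ h y ℕ.≡ᵇ i) ys
    ≡⟨ count-cong ys (λ _ → ≡ᵇ-cong-⇔ (mk⇔ ∸-intro ∸-elim)) ⟩
  F s
    ≡⟨ sym (ℕₚ.*-identityˡ (F s)) ⟩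
  1 ℕ.* F s
    ≡⟨ cong (λ b → toℕ b ℕ.* F s) (sym (dec-true (s ℕₚ.≟ s) refl)) ⟩
  toℕ (s ℕ.≡ᵇ s) ℕ.* F s
    ≡⟨ sym (∑-single i s s≤i (λ a _ a≢s → cong (λ b → toℕ b ℕ.* F a) (dec-false (s ℕₚ.≟ a) (a≢s ∘ sym)))) ⟩
  ∑[ a ≤ i ] (toℕ (s ℕ.≡ᵇ a) ℕ.* F a) ∎
  where
  open ≡-Reasoning
  F : ℕ → ℕ
  F a = count (λ y → h y ℕ.≡ᵇ i ∸ a) ys
  ∸-intro : ∀ {t} → s ℕ.+ t ≡ i → t ≡ i ∸ s
  ∸-intro {t} refl = sym (ℕₚ.m+n∸m≡n s t)
  ∸-elim : ∀ {t} → t ≡ i ∸ s → s ℕ.+ t ≡ i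
  ∸-elim refl = ℕₚ.m+[n∸m]≡n s≤i
... | no s≰i = begin
  count (λ y → s ℕ.+ h y ℕ.≡ᵇ i) ys
    ≡⟨ count-cong ys (λ {y} _ → dec-false (s ℕ.+ h y ℕₚ.≟ i) (λ { refl → s≰i (ℕₚ.m≤m+n s (h y)) })) ⟩
  count (λ _ → false) ys
    ≡⟨ count-false ys ⟩
  0
    ≡⟨ sym (∑-zero i (λ a a≤i → cong (λ b → toℕ b ℕ.* F a) (dec-false (s ℕₚ.≟ a) (λ { refl → s≰i a≤i })))) ⟩
  ∑[ a ≤ i ] (toℕ (s ℕ.≡ᵇ a) ℕ.* F a) ∎
  where
  open ≡-Reasoning
  F : ℕ → ℕ
  F a = count (λ y → h y ℕ.≡ᵇ i ∸ a) ys

count-convolution : ∀ (f : C → ℕ) (g : A → ℕ) (h : B → ℕ) (_∙_ : A → B → C) → (∀ x y → f (x ∙ y) ≡ g x ℕ.+ h y) →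
                    ∀ i xs ys → count (λ z → f z ℕ.≡ᵇ i) (concatMap (λ x → map (x ∙_) ys) xs)
                              ≡ ∑[ a ≤ i ] (count (λ x → g x ℕ.≡ᵇ a) xs ℕ.* count (λ y → h y ℕ.≡ᵇ i ∸ a) ys)
count-convolution f g h _∙_ f-∙ i []       ys = sym (∑-zero i (λ _ _ → refl))
count-convolution {C = C} {A = A} f g h _∙_ f-∙ i (x ∷ xs) ys = begin
  count P (map (x ∙_) ys ++ concatMap (λ x → map (x ∙_) ys) xs)
    ≡⟨ count-++ P (map (x ∙_) ys) _ ⟩
  count P (map (x ∙_) ys) ℕ.+ count P (concatMap (λ x → map (x ∙_) ys) xs)
    ≡⟨ cong₂ ℕ._+_ (trans (count-map P (x ∙_) ys) (count-cong ys (λ {y} _ → cong (ℕ._≡ᵇ i) (f-∙ x y))))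
                   (count-convolution f g h _∙_ f-∙ i xs ys) ⟩
  count (λ y → g x ℕ.+ h y ℕ.≡ᵇ i) ys ℕ.+ ∑[ a ≤ i ] (G xs a ℕ.* H a)
    ≡⟨ cong (ℕ._+ ∑[ a ≤ i ] (G xs a ℕ.* H a)) (count-+-shift h (g x) i ys) ⟩
  ∑[ a ≤ i ] (toℕ (g x ℕ.≡ᵇ a) ℕ.* H a) ℕ.+ ∑[ a ≤ i ] (G xs a ℕ.* H a)
    ≡⟨ sym (∑-distrib-+ i _ _) ⟩
  ∑[ a ≤ i ] (toℕ (g x ℕ.≡ᵇ a) ℕ.* H a ℕ.+ G xs a ℕ.* H a)
    ≡⟨ ∑-cong i (λ a _ → trans (sym (ℕₚ.*-distribʳ-+ (H a) (toℕ (g x ℕ.≡ᵇ a)) (G xs a)))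
                               (cong (ℕ._* H a) (sym (count-∷ (λ x → g x ℕ.≡ᵇ a) x xs)))) ⟩
  ∑[ a ≤ i ] (G (x ∷ xs) a ℕ.* H a) ∎
  where
  open ≡-Reasoning
  P : C → Bool
  P z = f z ℕ.≡ᵇ i
  G : List A → ℕ → ℕ
  G xs a = count (λ x → g x ℕ.≡ᵇ a) xs
  H : ℕ → ℕ
  H a = count (λ y → h y ℕ.≡ᵇ i ∸ a) ys

#312 : (List ℕ → ℕ) → ℕ → ℕ → ℕ
#312 f i n = count (λ π → f π ℕ.≡ᵇ i) (Sym312 n)

#312-suc : ∀ (f g h : List ℕ → ℕ) → (∀ α β → f (glue α β) ≡ g α ℕ.+ h β) → ∀ i n →
           #312 f i (suc n) ≡ ∑[ c ≤ n ] ∑[ a ≤ i ] (#312 g a c ℕ.* #312 h (i ∸ a) (n ∸ c))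
#312-suc f g h f-glue i n = begin
  #312 f i (suc n)                    ≡⟨ count-↭ P (Sym312-suc↭gluings n) ⟩
  count P (gluings n)                 ≡⟨ count-concatMap-applyUpTo P (gluingsAt n) id n ⟩
  ∑[ c ≤ n ] count P (gluingsAt n c)  ≡⟨ ∑-cong n (λ c _ → count-convolution f g h glue f-glue i (Sym312 c) (Sym312 (n ∸ c))) ⟩
  ∑[ c ≤ n ] ∑[ a ≤ i ] (#312 g a c ℕ.* #312 h (i ∸ a) (n ∸ c)) ∎
  where
  open ≡-Reasoning
  P : List ℕ → Bool
  P π = f π ℕ.≡ᵇ i

length-Sym312 : ∀ n → length (Sym312 n) ≡ catalan n
length-Sym312 = CatalanClosedForm.c≡catalan (length ∘ Sym312) refl length-Sym312-suc
  where
  open ≡-Reasoning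
  length-Sym312-suc : ∀ n → length (Sym312 (suc n)) ≡ ∑[ c ≤ n ] (length (Sym312 c) ℕ.* length (Sym312 (n ∸ c)))
  length-Sym312-suc n = begin
    length (Sym312 (suc n))                                ≡⟨ sym (count-true (Sym312 (suc n))) ⟩
    #312 (λ _ → 0) 0 (suc n)                               ≡⟨ #312-suc (λ _ → 0) (λ _ → 0) (λ _ → 0) (λ _ _ → refl) 0 n ⟩
    ∑[ c ≤ n ] (#312 (λ _ → 0) 0 c ℕ.* #312 (λ _ → 0) 0 (n ∸ c))
      ≡⟨ ∑-cong n (λ c _ → cong₂ ℕ._*_ (count-true (Sym312 c)) (count-true (Sym312 (n ∸ c)))) ⟩
    ∑[ c ≤ n ] (length (Sym312 c) ℕ.* length (Sym312 (n ∸ c))) ∎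

-- Shifted fixed points

fpShiftFrom : ℕ → ℕ → List ℕ → ℕ
fpShiftFrom m p []       = 0
fpShiftFrom m p (a ∷ as) = toℕ (m ℕ.+ a ℕ.≡ᵇ p) ℕ.+ fpShiftFrom m (suc p) as

fpShift : ℕ → List ℕ → ℕ
fpShift m = fpShiftFrom m 1

fpFrom≡fpShiftFrom : ∀ p π → fpFrom p π ≡ fpShiftFrom 0 p π
fpFrom≡fpShiftFrom p []       = refl
fpFrom≡fpShiftFrom p (a ∷ as) = cong (toℕ (a ℕ.≡ᵇ p) ℕ.+_) (fpFrom≡fpShiftFrom (suc p) as)

fpShiftFrom-++ : ∀ m p xs ys → fpShiftFrom m p (xs ++ ys) ≡ fpShiftFrom m p xs ℕ.+ fpShiftFrom m (length xs ℕ.+ p) ys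
fpShiftFrom-++ m p []       ys = refl
fpShiftFrom-++ m p (x ∷ xs) ys = begin
  toℕ (m ℕ.+ x ℕ.≡ᵇ p) ℕ.+ fpShiftFrom m (suc p) (xs ++ ys)
    ≡⟨ cong (toℕ (m ℕ.+ x ℕ.≡ᵇ p) ℕ.+_) (fpShiftFrom-++ m (suc p) xs ys) ⟩
  toℕ (m ℕ.+ x ℕ.≡ᵇ p) ℕ.+ (fpShiftFrom m (suc p) xs ℕ.+ fpShiftFrom m (length xs ℕ.+ suc p) ys)
    ≡⟨ sym (ℕₚ.+-assoc (toℕ (m ℕ.+ x ℕ.≡ᵇ p)) _ _) ⟩
  fpShiftFrom m p (x ∷ xs) ℕ.+ fpShiftFrom m (length xs ℕ.+ suc p) ys
    ≡⟨ cong (λ q → fpShiftFrom m p (x ∷ xs) ℕ.+ fpShiftFrom m q ys) (ℕₚ.+-suc (length xs) p) ⟩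
  fpShiftFrom m p (x ∷ xs) ℕ.+ fpShiftFrom m (suc (length xs ℕ.+ p)) ys ∎
  where open ≡-Reasoning

fpShiftFrom-map-suc : ∀ m p xs → fpShiftFrom m p (map suc xs) ≡ fpShiftFrom (suc m) p xs
fpShiftFrom-map-suc m p []       = refl
fpShiftFrom-map-suc m p (x ∷ xs) =
  cong₂ (λ v n → toℕ (v ℕ.≡ᵇ p) ℕ.+ n) (ℕₚ.+-suc m x) (fpShiftFrom-map-suc m (suc p) xs)

fpShiftFrom-map-+ : ∀ m k p xs → fpShiftFrom m (k ℕ.+ p) (map (k ℕ.+_) xs) ≡ fpShiftFrom m p xs
fpShiftFrom-map-+ m k p []       = refl
fpShiftFrom-map-+ m k p (x ∷ xs) = cong₂ ℕ._+_
  (cong toℕ (trans (cong (ℕ._≡ᵇ k ℕ.+ p) (swap m k x)) (≡ᵇ-+-cancelˡ k (m ℕ.+ x) p)))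
  (trans (cong (λ q → fpShiftFrom m q (map (k ℕ.+_) xs)) (sym (ℕₚ.+-suc k p))) (fpShiftFrom-map-+ m k (suc p) xs))
  where
  swap : ∀ m k x → m ℕ.+ (k ℕ.+ x) ≡ k ℕ.+ (m ℕ.+ x)
  swap = solve-∀

-- Gluing contributes the fixed points of α at level m + 1 and, when |α| = m, the entry 1.
prefixFp : ℕ → List ℕ → ℕ
prefixFp m α = fpShift (suc m) α ℕ.+ toℕ (m ℕ.≡ᵇ length α)

fpShift-glue : ∀ m α β → fpShift m (glue α β) ≡ prefixFp m α ℕ.+ fpShift m β
fpShift-glue m α β = begin
  fpShiftFrom m 1 (map suc α ++ 1 ∷ R)
    ≡⟨ fpShiftFrom-++ m 1 (map suc α) (1 ∷ R) ⟩
  fpShiftFrom m 1 (map suc α) ℕ.+ fpShiftFrom m (length (map suc α) ℕ.+ 1) (1 ∷ R)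
    ≡⟨ cong₂ ℕ._+_ (fpShiftFrom-map-suc m 1 α) (cong (λ q → fpShiftFrom m (q ℕ.+ 1) (1 ∷ R)) (Listₚ.length-map suc α)) ⟩
  fpShift (suc m) α ℕ.+ (toℕ (m ℕ.+ 1 ℕ.≡ᵇ c ℕ.+ 1) ℕ.+ fpShiftFrom m (suc c ℕ.+ 1) R)
    ≡⟨ cong₂ (λ b t → fpShift (suc m) α ℕ.+ (toℕ b ℕ.+ t))
             (cong₂ ℕ._≡ᵇ_ (ℕₚ.+-comm m 1) (ℕₚ.+-comm c 1)) (fpShiftFrom-map-+ m (suc c) 1 β) ⟩
  fpShift (suc m) α ℕ.+ (toℕ (m ℕ.≡ᵇ c) ℕ.+ fpShift m β)
    ≡⟨ sym (ℕₚ.+-assoc (fpShift (suc m) α) _ _) ⟩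
  prefixFp m α ℕ.+ fpShift m β ∎
  where
  open ≡-Reasoning
  c : ℕ
  c = length α
  R : List ℕ
  R = map (suc c ℕ.+_) β

fpShiftFrom-vanishes : ∀ m p α → All (1 ≤_) α → length α ℕ.+ p ≤ suc m → fpShiftFrom m p α ≡ 0
fpShiftFrom-vanishes m p []       _            _  = refl
fpShiftFrom-vanishes m p (a ∷ as) (1≤a ∷ 1≤as) le = cong₂ ℕ._+_
  (cong toℕ (dec-false (m ℕ.+ a ℕₚ.≟ p) (λ m+a≡p → ℕₚ.<-irrefl (sym m+a≡p) (ℕₚ.≤-<-trans p≤m (ℕₚ.m<m+n m 1≤a)))))
  (fpShiftFrom-vanishes m (suc p) as 1≤as (subst (_≤ suc m) (sym (ℕₚ.+-suc (length as) p)) le))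
  where
  p≤m : p ≤ m
  p≤m = ℕₚ.≤-trans (ℕₚ.m≤n+m p (length as)) (ℕₚ.≤-pred le)

fpShift-Sym312 : ∀ {m α} → α ∈ Sym312 m → fpShift (suc m) α ≡ 0
fpShift-Sym312 {m} {α} α∈ = fpShiftFrom-vanishes (suc m) 1 α (All.map proj₁ inRange)
  (subst (λ k → k ℕ.+ 1 ≤ suc (suc m)) (sym length≡) (ℕₚ.≤-trans (ℕₚ.≤-reflexive (ℕₚ.+-comm m 1)) (ℕₚ.n≤1+n (suc m))))
  where open IsPerm (proj₁ (Equivalence.to (∈-Sym312⇔ m) α∈))

#312-prefixFp-off : ∀ m a c → c ≢ m → #312 (prefixFp m) a c ≡ #312 (fpShift (suc m)) a c
#312-prefixFp-off m a c c≢m = count-cong (Sym312 c) λ {α} α∈ → cong (ℕ._≡ᵇ a) (begin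
  fpShift (suc m) α ℕ.+ toℕ (m ℕ.≡ᵇ length α)  ≡⟨ cong (λ b → fpShift (suc m) α ℕ.+ toℕ b) (m≢length α∈) ⟩
  fpShift (suc m) α ℕ.+ 0                      ≡⟨ ℕₚ.+-identityʳ _ ⟩
  fpShift (suc m) α                            ∎)
  where
  open ≡-Reasoning
  m≢length : ∀ {α} → α ∈ Sym312 c → (m ℕ.≡ᵇ length α) ≡ false
  m≢length α∈ = dec-false (m ℕₚ.≟ _) (λ m≡ → c≢m (trans (sym (Sym312⇒length≡ c α∈)) (sym m≡)))

#312-prefixFp-diag : ∀ m a → #312 (prefixFp m) a m ≡ count (λ _ → 1 ℕ.≡ᵇ a) (Sym312 m)
#312-prefixFp-diag m a = count-cong (Sym312 m) λ {α} α∈ → cong (ℕ._≡ᵇ a)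
  (cong₂ (λ k b → k ℕ.+ toℕ b) (fpShift-Sym312 α∈) (dec-true (m ℕₚ.≟ length α) (sym (Sym312⇒length≡ m α∈))))

#312-fpShift-diag : ∀ m a → #312 (fpShift (suc m)) a m ≡ count (λ _ → 0 ℕ.≡ᵇ a) (Sym312 m)
#312-fpShift-diag m a = count-cong (Sym312 m) (cong (ℕ._≡ᵇ a) ∘ fpShift-Sym312)

-- The generating series

module FixedPointSeries where

  open FormalSeries
  open import Data.Integer.Base using (_+_; _*_)
  open ≡-Reasoning

  G : ℕ → Series
  G m i n = + #312 (fpShift m) i n

  +-∑ : ∀ n (f : ℕ → ℕ) → + (∑[ k ≤ n ] f k) ≡ ℤΣ.∑≤ n (λ k → + f k)
  +-∑ zero    f = refl
  +-∑ (suc n) f = trans (ℤₚ.pos-+ (∑≤ n f) (f (suc n))) (cong (_+ (+ f (suc n))) (+-∑ n f))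

  -- On the diagonal the prefix statistic is 1 on every α ∈ 𝔖ₘ(312) while fpShift (m + 1) is 0,
  -- and their difference is |𝔖ₘ(312)| (x − 1) = Cₘ (x − 1).
  diagonal-coeff : ∀ (xs : List (List ℕ)) a →
                   + count (λ _ → 1 ℕ.≡ᵇ a) xs ≡ + length xs * x-1 a 0 + + count (λ _ → 0 ℕ.≡ᵇ a) xs
  diagonal-coeff xs zero = begin
    + count (λ _ → false) xs                  ≡⟨ cong +_ (count-false xs) ⟩
    0ℤ                                        ≡⟨ sym (ℤₚ.+-inverseˡ (+ length xs)) ⟩
    - + length xs + + length xs               ≡⟨ cong₂ _+_ (sym (trans (ℤₚ.*-comm (+ length xs) (- + 1)) (ℤₚ.-1*i≡-i (+ length xs))))
                                                            (cong +_ (sym (count-true xs))) ⟩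
    + length xs * - + 1 + + count (λ _ → true) xs ∎
  diagonal-coeff xs (suc zero) = begin
    + count (λ _ → true) xs                   ≡⟨ cong +_ (count-true xs) ⟩
    + length xs                               ≡⟨ sym (ℤₚ.*-identityʳ (+ length xs)) ⟩
    + length xs * + 1                         ≡⟨ sym (ℤₚ.+-identityʳ _) ⟩
    + length xs * + 1 + 0ℤ                    ≡⟨ cong (λ k → + length xs * + 1 + + k) (sym (count-false xs)) ⟩
    + length xs * + 1 + + count (λ _ → false) xs ∎
  diagonal-coeff xs (suc (suc a)) = begin
    + count (λ _ → false) xs                  ≡⟨ cong +_ (count-false xs) ⟩
    0ℤ                                        ≡⟨ sym (ℤₚ.*-zeroʳ (+ length xs)) ⟩
    + length xs * 0ℤ                          ≡⟨ sym (ℤₚ.+-identityʳ _) ⟩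
    + length xs * 0ℤ + 0ℤ                     ≡⟨ cong (λ k → + length xs * 0ℤ + + k) (sym (count-false xs)) ⟩
    + length xs * 0ℤ + + count (λ _ → false) xs ∎

  cfLevel-coeff : ∀ m a c → + #312 (prefixFp m) a c ≡ cfLevel m (G (suc m)) a (suc c)
  cfLevel-coeff m a c with c ℕₚ.≟ m
  ... | no c≢m = begin
    + #312 (prefixFp m) a c
      ≡⟨ cong +_ (#312-prefixFp-off m a c c≢m) ⟩
    G (suc m) a c
      ≡⟨ sym (ℤₚ.+-identityˡ _) ⟩
    0ℤ + G (suc m) a c
      ≡⟨ cong₂ _+_ (sym (levelTerm-coeff-off m a c c≢m)) (sym (zS⊛-coeff-suc (G (suc m)) a c)) ⟩
    levelTerm m a (suc c) + (zS ⊛ G (suc m)) a (suc c) ∎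
  ... | yes refl = begin
    + #312 (prefixFp c) a c
      ≡⟨ cong +_ (#312-prefixFp-diag c a) ⟩
    + count (λ _ → 1 ℕ.≡ᵇ a) (Sym312 c)
      ≡⟨ diagonal-coeff (Sym312 c) a ⟩
    + length (Sym312 c) * x-1 a 0 + + count (λ _ → 0 ℕ.≡ᵇ a) (Sym312 c)
      ≡⟨ cong₂ (λ k n → + k * x-1 a 0 + + n) (length-Sym312 c) (sym (#312-fpShift-diag c a)) ⟩
    + catalan c * x-1 a 0 + G (suc c) a c
      ≡⟨ cong₂ _+_ (sym (levelTerm-coeff-diag c a)) (sym (zS⊛-coeff-suc (G (suc c)) a c)) ⟩
    levelTerm c a (suc c) + (zS ⊛ G (suc c)) a (suc c) ∎

  G-fixpoint : ∀ m i n → G m i n ≡ (oneS ⊕ (cfLevel m (G (suc m)) ⊛ G m)) i n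
  G-fixpoint m i zero =
    trans (G-constant i) (sym (trans (cong (_+_ (oneS i 0)) (⊛-zDivisibleˡ Am (G m) zdA i)) (ℤₚ.+-identityʳ (oneS i 0))))
    where
    Am : Series
    Am = cfLevel m (G (suc m))
    zdA : ZDivisible Am
    zdA = cfLevel-zDivisible m (G (suc m))
    G-constant : ∀ i → G m i 0 ≡ oneS i 0
    G-constant zero    = refl
    G-constant (suc i) = refl
  G-fixpoint m i (suc n) = begin
    + #312 (fpShift m) i (suc n)
      ≡⟨ cong +_ (#312-suc (fpShift m) (prefixFp m) (fpShift m) (fpShift-glue m) i n) ⟩
    + (∑[ c ≤ n ] ∑[ a ≤ i ] (E c a ℕ.* N (i ∸ a) (n ∸ c)))
      ≡⟨ trans (+-∑ n (λ c → ∑[ a ≤ i ] (E c a ℕ.* N (i ∸ a) (n ∸ c))))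
               (ℤΣ.∑-cong n (λ c _ → trans (+-∑ i (λ a → E c a ℕ.* N (i ∸ a) (n ∸ c)))
                                          (ℤΣ.∑-cong i (λ a _ → ℤₚ.pos-* (E c a) (N (i ∸ a) (n ∸ c)))))) ⟩
    ℤΣ.∑≤ n (λ c → ℤΣ.∑≤ i (λ a → + E c a * G m (i ∸ a) (n ∸ c)))
      ≡⟨ ℤΣ.∑-comm n i _ ⟩
    ℤΣ.∑≤ i (λ a → ℤΣ.∑≤ n (λ c → + E c a * G m (i ∸ a) (n ∸ c)))
      ≡⟨ ℤΣ.∑-cong i (λ a _ → ℤΣ.∑-cong n (λ c _ → cong (_* G m (i ∸ a) (n ∸ c)) (cfLevel-coeff m a c))) ⟩
    ℤΣ.∑≤ i (λ a → ℤΣ.∑≤ n (λ c → Am a (suc c) * G m (i ∸ a) (n ∸ c)))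
      ≡⟨ sym (⊛-coeff-suc Am (G m) (cfLevel-zDivisible m (G (suc m))) i n) ⟩
    (Am ⊛ G m) i (suc n)
      ≡⟨ sym (trans (cong (_+ (Am ⊛ G m) i (suc n)) (oneS-coeff-suc i n)) (ℤₚ.+-identityˡ _)) ⟩
    oneS i (suc n) + (Am ⊛ G m) i (suc n) ∎
    where
    Am : Series
    Am = cfLevel m (G (suc m))
    E N : ℕ → ℕ → ℕ
    E c a = #312 (prefixFp m) a c
    N = #312 (fpShift m)

theorem3p7 : (n k d : ℕ) → n < d →
    cf 0 d k n ≡ + count312 n k
theorem3p7 n k d n<d = trans (cf-converges G G-fixpoint d 0 k n n<d)
                             (cong +_ (count-cong (Sym312 n) (λ {π} _ → cong (ℕ._≡ᵇ k) (sym (fpFrom≡fpShiftFrom 1 π)))))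
  where
  open FormalSeries using (cf-converges)
  open FixedPointSeries using (G; G-fixpoint)
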